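{- For every $k\geq1$, let $p^k_{n,m}$ be the number of paths in $\mathcal{A}_n$ having $m$ occurrences of the $k$-pyramid $U^kD_k$, and $P_k(x,y)=\sum_{n,m\geq0}p^k_{n,m}x^ny^m$. Then $$P_k(x,y)=\frac{x^{k+1}(y-1)-2x^{k+2}(y-1)+x^2+x-1+\sqrt{Q}}{2\left(x^{k+2}(y-1)-x\right)},$$ where $Q=x^{k+1}(y-1)\left(x^{k+1}(y-1)+4x+2(x^2-x-1)\right)+(x^2+x+1)(x^2-3x+1)$.
   Context: A Dyck path with air pockets is a non-empty lattice path in the first quadrant starting at the origin, ending on the $x$-axis, with up-steps $U=(1,1)$ and down-steps $D_k=(1,-k)$, $k\ge1$, no two down-steps consecutive. Its length is its number of steps; $\mathcal{A}_n$ is the set of such paths of length $n$. For $k\ge1$, an occurrence of the $k$-pyramid $\Delta_k$ is an occurrence of the factor (consecutive steps) $U^kD_k$ in the path. -}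

module Defs where

open import Data.Nat as ℕ using (ℕ; zero; suc; _∸_; _≤ᵇ_; _≡ᵇ_)
open import Data.Bool using (Bool; true; false; _∧_; if_then_else_)
open import Data.List using (List; []; _∷_; length; filter; replicate; _++_; concatMap; map)
open import Data.Integer as ℤ using (ℤ; +_)
open import Data.Product using (_×_)
open import Relation.Binary.PropositionalEquality using (_≡_)
open import Relation.Nullary.Decidable using (Dec)
open import Data.Bool using (T)
open import Data.Bool.Properties using (T?)

-- U = (1,1);  D k = (1,-k)  (a genuine down-step requires k ≥ 1,
-- which is enforced by the validity check below)
data Step : Set where
  U : Step
  D : ℕ → Step

go : ℕ → Bool → List Step → Bool
go h _     []          = h ≡ᵇ 0
go h _     (U ∷ w)     = go (suc h) false w
go h true  (D k ∷ w)   = false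
go h false (D k ∷ w)   = (1 ≤ᵇ k) ∧ (k ≤ᵇ h) ∧ go (h ∸ k) true w

isAirDyck : List Step → Bool
isAirDyck []      = false
isAirDyck (s ∷ w) = go 0 false (s ∷ w)

_==ₛ_ : Step → Step → Bool
U   ==ₛ U   = true
U   ==ₛ D _ = false
D _ ==ₛ U   = false
D a ==ₛ D b = a ≡ᵇ b

isPrefix : List Step → List Step → Bool
isPrefix []      _       = true
isPrefix (_ ∷ _) []      = false
isPrefix (a ∷ p) (b ∷ w) = (a ==ₛ b) ∧ isPrefix p w

occurrences : List Step → List Step → ℕ
occurrences p []      = if isPrefix p [] then 1 else 0
occurrences p (s ∷ w) = (if isPrefix p (s ∷ w) then 1 else 0) ℕ.+ occurrences p w

pyramid : ℕ → List Step
pyramid k = replicate k U ++ (D k ∷ [])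

-- Every path of 𝒜_n uses only down-steps D_k with k ≤ n (heights never
-- exceed n), so filtering these with isAirDyck yields exactly 𝒜_n.
alphabet : ℕ → List Step
alphabet n = U ∷ map (λ i → D (suc i)) (Data.List.upTo n)

wordsOver : List Step → ℕ → List (List Step)
wordsOver a zero    = [] ∷ []
wordsOver a (suc l) = concatMap (λ w → map (λ s → s ∷ w) a) (wordsOver a l)

words : ℕ → List (List Step)
words n = wordsOver (alphabet n) n

𝒜 : ℕ → List (List Step)
𝒜 n = filter (λ w → T? (isAirDyck w)) (words n)

p : ℕ → ℕ → ℕ → ℕ
p k n m = length (filter (λ w → T? (occurrences (pyramid k) w ≡ᵇ m)) (𝒜 n))

-- Formal power series in x, y over ℤ :  f n m = [x^n y^m] f

FPS : Set
FPS = ℕ → ℕ → ℤ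

Σ≤ : ℕ → (ℕ → ℤ) → ℤ
Σ≤ zero    f = f 0
Σ≤ (suc n) f = Σ≤ n f ℤ.+ f (suc n)

infixl 6 _⊕_ _⊖_
infixl 7 _⊗_
infixr 8 _^^_
infix 4 _≈_

_⊕_ : FPS → FPS → FPS
(f ⊕ g) n m = f n m ℤ.+ g n m

_⊖_ : FPS → FPS → FPS
(f ⊖ g) n m = f n m ℤ.- g n m

_⊗_ : FPS → FPS → FPS
(f ⊗ g) n m = Σ≤ n (λ i → Σ≤ m (λ j → f i j ℤ.* g (n ∸ i) (m ∸ j)))

const : ℤ → FPS
const c zero zero = c
const c _    _    = + 0

𝟙 : FPS
𝟙 = const (+ 1)

X : FPS
X (suc zero) zero = + 1
X _          _    = + 0

Y : FPS
Y zero (suc zero) = + 1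
Y _    _          = + 0

_^^_ : FPS → ℕ → FPS
f ^^ zero  = 𝟙
f ^^ suc n = f ⊗ (f ^^ n)

_≈_ : FPS → FPS → Set
f ≈ g = ∀ n m → f n m ≡ g n m

-- S is the (principal) formal square root of Q: S² = Q and constant term 1
-- (Q has constant term 1, so this determines S uniquely)
IsSqrt : FPS → FPS → Set
IsSqrt S Q = (S ⊗ S ≈ Q) × (S 0 0 ≡ + 1)

Pk : ℕ → FPS
Pk k n m = + (p k n m)

Num : ℕ → FPS
Num k = X ^^ (k ℕ.+ 1) ⊗ (Y ⊖ 𝟙) ⊖ const (+ 2) ⊗ X ^^ (k ℕ.+ 2) ⊗ (Y ⊖ 𝟙)
        ⊕ X ^^ 2 ⊕ X ⊖ 𝟙

Den : ℕ → FPS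
Den k = const (+ 2) ⊗ (X ^^ (k ℕ.+ 2) ⊗ (Y ⊖ 𝟙) ⊖ X)

Qk : ℕ → FPS
Qk k = X ^^ (k ℕ.+ 1) ⊗ (Y ⊖ 𝟙)
         ⊗ (X ^^ (k ℕ.+ 1) ⊗ (Y ⊖ 𝟙) ⊕ const (+ 4) ⊗ X
            ⊕ const (+ 2) ⊗ (X ^^ 2 ⊖ X ⊖ 𝟙))
       ⊕ (X ^^ 2 ⊕ X ⊕ 𝟙) ⊗ (X ^^ 2 ⊖ const (+ 3) ⊗ X ⊕ 𝟙)

module Submission where

-- Cutting a nonempty path at its first return to the x-axis gives P = B (1 + P), where B counts
-- prime paths (those touching the axis only at their end). The prime paths are U D₁ and the raises
-- U w D_{j+1} of the paths w D_j; raising keeps every k-pyramid except one ending w D_j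
-- (w = β U^k, j = k), and the pyramid of U^k D_k itself is new. Hence
-- B = x² + x P + x^{k+1} (y - 1) - x^{k+2} (y - 1) (1 + P), so P is a root of a quadratic with
-- discriminant Q: (Den P - Num)² = Q, and Den P - Num has constant term 1.

open import Algebra.Bundles using (CommutativeRing)
open import Data.Nat as ℕ using (ℕ; zero; suc; _∸_; _≤_; z≤n)
import Data.Nat.Properties as ℕP
import Relation.Binary.PropositionalEquality as P
import Relation.Binary.Reasoning.Setoid as SR
import Algebra.Construct.Pointwise


module PowerSeries {c ℓ} (R : CommutativeRing c ℓ) where
  open CommutativeRing R
  open SR setoid

  ∑ : ℕ → (ℕ → Carrier) → Carrier
  ∑ zero f = f 0
  ∑ (suc n) f = ∑ n f + f (suc n)

  ∑-cong≤ : ∀ n {f g} → (∀ i → i ≤ n → f i ≈ g i) → ∑ n f ≈ ∑ n g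
  ∑-cong≤ zero h = h 0 z≤n
  ∑-cong≤ (suc n) h = +-cong (∑-cong≤ n (λ i le → h i (ℕP.m≤n⇒m≤1+n le))) (h (suc n) ℕP.≤-refl)

  ∑-cong : ∀ n {f g} → (∀ i → f i ≈ g i) → ∑ n f ≈ ∑ n g
  ∑-cong n h = ∑-cong≤ n (λ i _ → h i)

  ∑-+ : ∀ n f g → ∑ n (λ i → f i + g i) ≈ ∑ n f + ∑ n g
  ∑-+ zero f g = refl
  ∑-+ (suc n) f g = trans (+-congʳ (∑-+ n f g)) (+-interchange _ _ _ _)
    where open import Algebra.Properties.CommutativeSemigroup +-commutativeSemigroup
            using () renaming (interchange to +-interchange)

  ∑-*ˡ : ∀ n a f → a * ∑ n f ≈ ∑ n (λ i → a * f i)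
  ∑-*ˡ zero a f = refl
  ∑-*ˡ (suc n) a f = trans (distribˡ a _ _) (+-congʳ (∑-*ˡ n a f))

  ∑-0 : ∀ n → ∑ n (λ _ → 0#) ≈ 0#
  ∑-0 zero = refl
  ∑-0 (suc n) = trans (+-identityʳ _) (∑-0 n)

  ∑-shift : ∀ n f → ∑ (suc n) f ≈ f 0 + ∑ n (λ i → f (suc i))
  ∑-shift zero f = refl
  ∑-shift (suc n) f = trans (+-congʳ (∑-shift n f)) (+-assoc _ _ _)

  ∑-reverse : ∀ n f → ∑ n f ≈ ∑ n (λ i → f (n ∸ i))
  ∑-reverse zero f = refl
  ∑-reverse (suc n) f = begin
    ∑ n f + f (suc n) ≈⟨ +-congʳ (∑-reverse n f) ⟩
    ∑ n (λ i → f (n ∸ i)) + f (suc n) ≈⟨ +-comm _ _ ⟩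
    f (suc n) + ∑ n (λ i → f (n ∸ i)) ≈⟨ sym (∑-shift n (λ i → f (suc n ∸ i))) ⟩
    ∑ (suc n) (λ i → f (suc n ∸ i)) ∎

  ∑-triangle : ∀ n (G : ℕ → ℕ → Carrier) →
    ∑ n (λ i → ∑ i (λ a → G a (i ∸ a))) ≈ ∑ n (λ a → ∑ (n ∸ a) (λ b → G a b))
  ∑-triangle zero G = refl
  ∑-triangle (suc n) G = begin
    ∑ n (λ i → ∑ i (λ a → G a (i ∸ a))) + ∑ (suc n) (λ a → G a (suc n ∸ a))
      ≈⟨ +-congʳ (∑-triangle n G) ⟩
    ∑ n (λ a → ∑ (n ∸ a) (λ b → G a b)) + (∑ n (λ a → G a (suc n ∸ a)) + G (suc n) (n ∸ n))
      ≈⟨ sym (+-assoc _ _ _) ⟩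
    (∑ n (λ a → ∑ (n ∸ a) (λ b → G a b)) + ∑ n (λ a → G a (suc n ∸ a))) + G (suc n) (n ∸ n)
      ≈⟨ +-congʳ (sym (∑-+ n _ _)) ⟩
    ∑ n (λ a → ∑ (n ∸ a) (λ b → G a b) + G a (suc n ∸ a)) + G (suc n) (n ∸ n)
      ≈⟨ +-congʳ (∑-cong≤ n (λ a le → reflexive (P.cong (λ z → ∑ (n ∸ a) (G a) + G a z) (ℕP.+-∸-assoc 1 le)))) ⟩
    ∑ n (λ a → ∑ (n ∸ a) (λ b → G a b) + G a (suc (n ∸ a))) + G (suc n) (n ∸ n)
      ≈⟨ +-cong (∑-cong≤ n (λ a le → reflexive (P.cong (λ z → ∑ z (G a)) (P.sym (ℕP.+-∸-assoc 1 le))))) (reflexive (P.trans (P.cong (G (suc n)) n∸n≡0) (P.cong (λ z → ∑ z (G (suc n))) (P.sym n∸n≡0)))) ⟩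
    ∑ (suc n) (λ a → ∑ (suc n ∸ a) (λ b → G a b)) ∎
    where
    n∸n≡0 : n ∸ n P.≡ 0
    n∸n≡0 = ℕP.n∸n≡0 n

  Series : Set c
  Series = ℕ → Carrier

  _≋_ : Series → Series → Set ℓ
  f ≋ g = ∀ n → f n ≈ g n

  _⊛_ : Series → Series → Series
  (f ⊛ g) n = ∑ n (λ i → f i * g (n ∸ i))

  δ : Series
  δ zero = 1#
  δ (suc _) = 0#

  ⊛-comm : ∀ f g → (f ⊛ g) ≋ (g ⊛ f)
  ⊛-comm f g n = begin
    ∑ n (λ i → f i * g (n ∸ i)) ≈⟨ ∑-reverse n _ ⟩
    ∑ n (λ i → f (n ∸ i) * g (n ∸ (n ∸ i))) ≈⟨ ∑-cong≤ n (λ i le → trans (*-comm _ _) (*-congʳ (reflexive (P.cong g (ℕP.m∸[m∸n]≡n le))))) ⟩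
    ∑ n (λ i → g i * f (n ∸ i)) ∎

  ⊛-identityˡ : ∀ f → (δ ⊛ f) ≋ f
  ⊛-identityˡ f zero = *-identityˡ _
  ⊛-identityˡ f (suc n) = begin
    ∑ (suc n) (λ i → δ i * f (suc n ∸ i)) ≈⟨ ∑-shift n _ ⟩
    1# * f (suc n) + ∑ n (λ i → 0# * f (n ∸ i)) ≈⟨ +-cong (*-identityˡ _) (trans (∑-cong n (λ i → zeroˡ _)) (∑-0 n)) ⟩
    f (suc n) + 0# ≈⟨ +-identityʳ _ ⟩
    f (suc n) ∎

  ⊛-distribˡ : ∀ f g h → (f ⊛ (λ n → g n + h n)) ≋ (λ n → (f ⊛ g) n + (f ⊛ h) n)
  ⊛-distribˡ f g h n = trans (∑-cong n (λ i → distribˡ _ _ _)) (∑-+ n _ _)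

  ⊛-cong : ∀ {f f' g g'} → f ≋ f' → g ≋ g' → (f ⊛ g) ≋ (f' ⊛ g')
  ⊛-cong e1 e2 n = ∑-cong n (λ i → *-cong (e1 i) (e2 (n ∸ i)))

  ⊛-assoc : ∀ f g h → ((f ⊛ g) ⊛ h) ≋ (f ⊛ (g ⊛ h))
  ⊛-assoc f g h n = begin
    ∑ n (λ i → ∑ i (λ a → f a * g (i ∸ a)) * h (n ∸ i))
      ≈⟨ ∑-cong n (λ i → trans (*-comm _ _) (∑-*ˡ i _ _)) ⟩
    ∑ n (λ i → ∑ i (λ a → h (n ∸ i) * (f a * g (i ∸ a))))
      ≈⟨ ∑-cong≤ n (λ i le → ∑-cong≤ i (λ a le2 → reflexive (P.cong (λ z → h (n ∸ z) * (f a * g (i ∸ a))) (P.sym (ℕP.m+[n∸m]≡n le2))))) ⟩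
    ∑ n (λ i → ∑ i (λ a → h (n ∸ (a ℕ.+ (i ∸ a))) * (f a * g (i ∸ a))))
      ≈⟨ ∑-triangle n (λ a b → h (n ∸ (a ℕ.+ b)) * (f a * g b)) ⟩
    ∑ n (λ a → ∑ (n ∸ a) (λ b → h (n ∸ (a ℕ.+ b)) * (f a * g b)))
      ≈⟨ ∑-cong n (λ a → ∑-cong (n ∸ a) (λ b → trans (*-comm _ _) (trans (*-assoc _ _ _) (*-congˡ (*-congˡ (reflexive (P.cong h (P.sym (ℕP.∸-+-assoc n a b))))))))) ⟩
    ∑ n (λ a → ∑ (n ∸ a) (λ b → f a * (g b * h (n ∸ a ∸ b))))
      ≈⟨ ∑-cong n (λ a → sym (∑-*ˡ (n ∸ a) _ _)) ⟩
    ∑ n (λ a → f a * ∑ (n ∸ a) (λ b → g b * h (n ∸ a ∸ b))) ∎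

  commutativeRing : CommutativeRing c ℓ
  commutativeRing = record
    { Carrier = Series
    ; _≈_ = _≋_
    ; _+_ = λ f g n → f n + g n
    ; _*_ = _⊛_
    ; -_ = λ f n → - f n
    ; 0# = λ _ → 0#
    ; 1# = δ
    ; isCommutativeRing = record
      { isRing = record
        { +-isAbelianGroup = Pointwise.isAbelianGroup +-isAbelianGroup
        ; *-cong = ⊛-cong
        ; *-assoc = ⊛-assoc
        ; *-identity = ⊛-identityˡ , (λ f n → trans (⊛-comm f δ n) (⊛-identityˡ f n))
        ; distrib = ⊛-distribˡ , (λ f g h n → trans (⊛-comm (λ m → g m + h m) f n) (trans (⊛-distribˡ f g h n) (+-cong (⊛-comm f g n) (⊛-comm f h n)))) }
      ; *-comm = ⊛-comm } }
    where
    open import Data.Product using (_,_)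
    module Pointwise = Algebra.Construct.Pointwise ℕ


open import Defs
open import Data.Bool using (Bool; true; false; _∧_; _∨_; if_then_else_)
open import Data.Bool.Properties using (T?; ∧-zeroʳ; ∧-identityʳ; ∨-identityʳ)
open import Data.Empty using (⊥-elim)
open import Data.Integer as ℤ using (ℤ; +_; -[1+_]; _+_; _*_; _-_)
import Data.Integer.Properties as ℤP
open import Data.Integer.Tactic.RingSolver using (solve-∀)
open import Data.List using (List; []; _∷_; _++_; length; map; filter; concatMap; take; drop; replicate; applyUpTo; initLast; _∷ʳ′_)
import Data.List.Properties as LP
open import Data.List.Membership.Propositional using (_∈_)
open import Data.List.Membership.Propositional.Properties using (∈-++⁺ʳ)
open import Data.List.Relation.Unary.Any using (here; there)
open import Data.Product using (Σ; ∃; _×_; _,_)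
open import Data.Sum using (_⊎_; inj₁; inj₂)
open import Function using (_∘_)
open import Relation.Binary.Definitions using (tri<; tri≈; tri>)
open import Relation.Nullary using (yes; no)
open import Data.Nat using (_<_; _≥_; s≤s; _≡ᵇ_; _≤ᵇ_)
open import Relation.Binary.PropositionalEquality using (_≡_; _≢_; refl; cong; cong₂; sym; trans; subst)


module IntegerSums where

  open import Algebra.Properties.CommutativeSemigroup ℤP.+-commutativeSemigroup using () renaming (interchange to +-interchange)

  ι : Bool → ℤ
  ι true = + 1
  ι false = + 0

  Σ≤-cong : ∀ n {f g : ℕ → ℤ} → (∀ i → f i ≡ g i) → Σ≤ n f ≡ Σ≤ n g
  Σ≤-cong zero h = h 0
  Σ≤-cong (suc n) h = cong₂ _+_ (Σ≤-cong n h) (h (suc n))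

  Σ≤-cong≤ : ∀ n {f g : ℕ → ℤ} → (∀ i → i ≤ n → f i ≡ g i) → Σ≤ n f ≡ Σ≤ n g
  Σ≤-cong≤ zero h = h 0 z≤n
  Σ≤-cong≤ (suc n) h = cong₂ _+_ (Σ≤-cong≤ n (λ i le → h i (ℕP.m≤n⇒m≤1+n le))) (h (suc n) ℕP.≤-refl)

  Σ≤-shift : ∀ n f → Σ≤ (suc n) f ≡ f 0 + Σ≤ n (λ i → f (suc i))
  Σ≤-shift zero f = refl
  Σ≤-shift (suc n) f = trans (cong (_+ f (suc (suc n))) (Σ≤-shift n f)) (ℤP.+-assoc (f 0) _ _)

  Σ≤-0 : ∀ n → Σ≤ n (λ _ → + 0) ≡ + 0
  Σ≤-0 zero = refl
  Σ≤-0 (suc n) = trans (ℤP.+-identityʳ _) (Σ≤-0 n)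

  Σ≤-+ : ∀ n f g → Σ≤ n (λ i → f i + g i) ≡ Σ≤ n f + Σ≤ n g
  Σ≤-+ zero f g = refl
  Σ≤-+ (suc n) f g = trans (cong (_+ (f (suc n) + g (suc n))) (Σ≤-+ n f g)) (+-interchange (Σ≤ n f) (Σ≤ n g) (f (suc n)) (g (suc n)))

  Σ≤-*ˡ : ∀ n c f → c * Σ≤ n f ≡ Σ≤ n (λ i → c * f i)
  Σ≤-*ˡ zero c f = refl
  Σ≤-*ˡ (suc n) c f = trans (ℤP.*-distribˡ-+ c _ _) (cong (_+ c * f (suc n)) (Σ≤-*ˡ n c f))

  Σ≤-first : ∀ n (f : ℕ → ℤ) → (∀ i → f (suc i) ≡ + 0) → Σ≤ n f ≡ f 0
  Σ≤-first zero f h = refl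
  Σ≤-first (suc n) f h = trans (cong₂ ℤ._+_ (Σ≤-first n f h) (h n)) (ℤP.+-identityʳ (f 0))

  Σ≤-vanishing : ∀ n f → (∀ i → i ≤ n → f i ≡ + 0) → Σ≤ n f ≡ + 0
  Σ≤-vanishing n f h = trans (Σ≤-cong≤ n h) (Σ≤-0 n)

  Σ≤-single : ∀ n c f → (∀ i → i ≢ c → f i ≡ + 0) → c ≤ n → Σ≤ n f ≡ f c
  Σ≤-single zero .zero f h z≤n = refl
  Σ≤-single (suc n) c f h le with c ℕ.≟ suc n
  ... | yes refl = trans (cong (_+ f (suc n)) (Σ≤-vanishing n f (λ i le2 → h i (λ e → ℕP.<⇒≢ (s≤s le2) e)))) (ℤP.+-identityˡ _)
  ... | no ne = trans (cong₂ _+_ (Σ≤-single n c f h (ℕP.≤-pred (ℕP.≤∧≢⇒< le ne))) (h (suc n) (λ e → ne (sym e)))) (ℤP.+-identityʳ _)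


module SeriesRing where

  open IntegerSums
  open import Level using (0ℓ)
  open import Algebra.Bundles using (RawRing)
  open import Algebra.Solver.Ring.AlmostCommutativeRing using (AlmostCommutativeRing; fromCommutativeRing; _-Raw-AlmostCommutative⟶_)
  open import Data.Maybe using (Maybe; just; nothing)

  -- The ring laws of FPS are inherited from series in x with coefficients in ℤ[[y]].
  module ℤ⟦y⟧ = PowerSeries ℤP.+-*-commutativeRing
  module ℤ⟦y⟧⟦x⟧ = PowerSeries ℤ⟦y⟧.commutativeRing
  module Nested = CommutativeRing ℤ⟦y⟧⟦x⟧.commutativeRing

  ∑≡Σ≤ : ∀ n f → ℤ⟦y⟧.∑ n f ≡ Σ≤ n f
  ∑≡Σ≤ zero f = refl
  ∑≡Σ≤ (suc n) f = cong (ℤ._+ f (suc n)) (∑≡Σ≤ n f)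

  ∑≡Σ≤-pointwise : ∀ n F m → ℤ⟦y⟧⟦x⟧.∑ n F m ≡ Σ≤ n (λ i → F i m)
  ∑≡Σ≤-pointwise zero F m = refl
  ∑≡Σ≤-pointwise (suc n) F m = cong (ℤ._+ F (suc n) m) (∑≡Σ≤-pointwise n F m)

  ⊗≈nested-product : ∀ f g → (f ⊗ g) ≈ Nested._*_ f g
  ⊗≈nested-product f g n m = sym (trans (∑≡Σ≤-pointwise n _ m) (Σ≤-cong n (λ i → ∑≡Σ≤ m _)))

  ≈-refl : ∀ {f} → f ≈ f
  ≈-refl n m = refl

  ≈-sym : ∀ {f g} → f ≈ g → g ≈ f
  ≈-sym e n m = sym (e n m)

  ≈-trans : ∀ {f g h} → f ≈ g → g ≈ h → f ≈ h
  ≈-trans e1 e2 n m = trans (e1 n m) (e2 n m)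

  𝟙≈δ : 𝟙 ≈ ℤ⟦y⟧⟦x⟧.δ
  𝟙≈δ zero zero = refl
  𝟙≈δ zero (suc m) = refl
  𝟙≈δ (suc n) m = refl

  neg : FPS → FPS
  neg f n m = ℤ.- f n m

  𝟘 : FPS
  𝟘 _ _ = + 0

  via-nested : ∀ f g h k → Nested._*_ f g ≈ Nested._*_ h k → f ⊗ g ≈ h ⊗ k
  via-nested f g h k e = ≈-trans (⊗≈nested-product f g) (≈-trans e (≈-sym (⊗≈nested-product h k)))

  FPS-commutativeRing : CommutativeRing 0ℓ 0ℓ
  FPS-commutativeRing = record
    { Carrier = FPS
    ; _≈_ = _≈_
    ; _+_ = _⊕_
    ; _*_ = _⊗_
    ; -_ = neg
    ; 0# = 𝟘
    ; 1# = 𝟙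
    ; isCommutativeRing = record
      { isRing = record
        { +-isAbelianGroup = Nested.+-isAbelianGroup
        ; *-cong = λ {f} {f'} {g} {g'} f≈f' g≈g' → via-nested f g f' g' (Nested.*-cong f≈f' g≈g')
        ; *-assoc = λ f g h → via-nested (f ⊗ g) h f (g ⊗ h)
            (≈-trans (Nested.*-cong (⊗≈nested-product f g) (≈-refl {h}))
              (≈-trans (Nested.*-assoc f g h) (Nested.*-cong (≈-refl {f}) (≈-sym (⊗≈nested-product g h)))))
        ; *-identity =
            (λ f → ≈-trans (⊗≈nested-product 𝟙 f) (≈-trans (Nested.*-cong 𝟙≈δ (≈-refl {f})) (Nested.*-identityˡ f))) ,
            (λ f → ≈-trans (⊗≈nested-product f 𝟙) (≈-trans (Nested.*-cong (≈-refl {f}) 𝟙≈δ) (Nested.*-identityʳ f)))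
        ; distrib =
            (λ f g h → ≈-trans (⊗≈nested-product f (g ⊕ h))
              (≈-trans (Nested.distribˡ f g h) (Nested.+-cong (≈-sym (⊗≈nested-product f g)) (≈-sym (⊗≈nested-product f h))))) ,
            (λ f g h → ≈-trans (⊗≈nested-product (g ⊕ h) f)
              (≈-trans (Nested.distribʳ f g h) (Nested.+-cong (≈-sym (⊗≈nested-product g f)) (≈-sym (⊗≈nested-product h f)))))
        }
      ; *-comm = λ f g → via-nested f g g f (Nested.*-comm f g)
      }
    }

  module FPS-ring = CommutativeRing FPS-commutativeRing

  FPS-almostCommutativeRing : AlmostCommutativeRing 0ℓ 0ℓ
  FPS-almostCommutativeRing = fromCommutativeRing FPS-commutativeRing

  const-*-homo : ∀ a b → const (a ℤ.* b) ≈ (const a ⊗ const b)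
  const-*-homo a b n m = sym (trans (Σ≤-first n _ (λ i → Σ≤-first m _ (λ j → refl)))
     (trans (Σ≤-first m _ (λ j → ℤP.*-zeroˡ (const b n (m ∸ suc j)))) (*-const n m)))
    where
    *-const : ∀ n m → a ℤ.* const b n m ≡ const (a ℤ.* b) n m
    *-const zero zero = refl
    *-const zero (suc m) = ℤP.*-zeroʳ a
    *-const (suc n) m = ℤP.*-zeroʳ a

  const-+-homo : ∀ a b → const (a ℤ.+ b) ≈ (const a ⊕ const b)
  const-+-homo a b zero zero = refl
  const-+-homo a b zero (suc m) = refl
  const-+-homo a b (suc n) m = refl

  const-‿homo : ∀ a → const (ℤ.- a) ≈ neg (const a)
  const-‿homo a zero zero = refl
  const-‿homo a zero (suc m) = refl
  const-‿homo a (suc n) m = refl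

  const-0-homo : const (+ 0) ≈ 𝟘
  const-0-homo zero zero = refl
  const-0-homo zero (suc m) = refl
  const-0-homo (suc n) m = refl

  ℤ-rawRing : RawRing 0ℓ 0ℓ
  ℤ-rawRing = CommutativeRing.rawRing ℤP.+-*-commutativeRing

  const-homomorphism : ℤ-rawRing -Raw-AlmostCommutative⟶ FPS-almostCommutativeRing
  const-homomorphism = record
    { ⟦_⟧ = const
    ; +-homo = const-+-homo
    ; *-homo = const-*-homo
    ; -‿homo = const-‿homo
    ; 0-homo = const-0-homo
    ; 1-homo = ≈-refl
    }

  const-cong : ∀ {a b} → a ≡ b → const a ≈ const b
  const-cong refl = ≈-refl

  const-≟ : ∀ a b → Maybe (const a ≈ const b)
  const-≟ a b with a ℤ.≟ b
  ... | yes e = just (const-cong e)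
  ... | no _ = nothing

  open import Algebra.Solver.Ring ℤ-rawRing FPS-almostCommutativeRing const-homomorphism const-≟ public


module ClosedForm where

  open SeriesRing

  open FPS-ring using (+-cong; +-congˡ; *-congˡ; +-identityˡ; +-identityʳ; zeroʳ)
  open import Algebra.Properties.Group FPS-ring.+-group using (x∙y⁻¹≈ε⇒x≈y; x≈y⇒x∙y⁻¹≈ε)
  open import Relation.Binary.Reasoning.Setoid FPS-ring.setoid

  primeForm : FPS → FPS → FPS
  primeForm w p = X ^^ 2 ⊕ X ⊗ p ⊕ w ⊗ (Y ⊖ 𝟙) ⊖ X ⊗ (w ⊗ (Y ⊖ 𝟙)) ⊗ (𝟙 ⊕ p)

  -- Den k, Num k and Qk k are these at w₁ = x^{k+1}, w₂ = x^{k+2}.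
  denominator : FPS → FPS
  denominator w₂ = const (+ 2) ⊗ (w₂ ⊗ (Y ⊖ 𝟙) ⊖ X)

  numerator : FPS → FPS → FPS
  numerator w₁ w₂ = w₁ ⊗ (Y ⊖ 𝟙) ⊖ const (+ 2) ⊗ w₂ ⊗ (Y ⊖ 𝟙) ⊕ X ^^ 2 ⊕ X ⊖ 𝟙

  discriminant : FPS → FPS
  discriminant w = w ⊗ (Y ⊖ 𝟙) ⊗ (w ⊗ (Y ⊖ 𝟙) ⊕ const (+ 4) ⊗ X ⊕ const (+ 2) ⊗ (X ^^ 2 ⊖ X ⊖ 𝟙))
                   ⊕ (X ^^ 2 ⊕ X ⊕ 𝟙) ⊗ (X ^^ 2 ⊖ const (+ 3) ⊗ X ⊕ 𝟙)

  a≈b⊕[a⊖b] : ∀ a b → a ≈ b ⊕ (a ⊖ b)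
  a≈b⊕[a⊖b] = solve 2 (λ a b → a := b :+ (a :- b)) FPS-ring.refl

  primeForm-unique : ∀ {b p c w} → c ≈ 𝟙 ⊕ p →
    b ⊕ X ⊗ w ⊗ (Y ⊗ c) ⊕ w ≈ X ^^ 2 ⊕ X ⊗ p ⊕ w ⊗ Y ⊕ X ⊗ w ⊗ c →
    b ≈ primeForm w p
  primeForm-unique {b} {p} {c} {w} c≈1+p equation = x∙y⁻¹≈ε⇒x≈y b (primeForm w p) (begin
    b ⊖ primeForm w p
      ≈⟨ defect b p c w X Y ⟩
    (b ⊕ X ⊗ w ⊗ (Y ⊗ c) ⊕ w ⊖ (X ^^ 2 ⊕ X ⊗ p ⊕ w ⊗ Y ⊕ X ⊗ w ⊗ c)) ⊕ t ⊗ ((𝟙 ⊕ p) ⊖ c)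
      ≈⟨ +-cong {u = t ⊗ ((𝟙 ⊕ p) ⊖ c)} (x≈y⇒x∙y⁻¹≈ε {y = X ^^ 2 ⊕ X ⊗ p ⊕ w ⊗ Y ⊕ X ⊗ w ⊗ c} equation)
                (*-congˡ {t} (x≈y⇒x∙y⁻¹≈ε {y = c} (FPS-ring.sym c≈1+p))) ⟩
    𝟘 ⊕ t ⊗ 𝟘  ≈⟨ +-identityˡ _ ⟩
    t ⊗ 𝟘      ≈⟨ zeroʳ t ⟩
    𝟘          ∎)
    where
    t : FPS
    t = X ⊗ (w ⊗ (Y ⊖ 𝟙))
    defect : ∀ b p c w x y →
      b ⊖ (x ^^ 2 ⊕ x ⊗ p ⊕ w ⊗ (y ⊖ 𝟙) ⊖ x ⊗ (w ⊗ (y ⊖ 𝟙)) ⊗ (𝟙 ⊕ p))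
        ≈ (b ⊕ x ⊗ w ⊗ (y ⊗ c) ⊕ w ⊖ (x ^^ 2 ⊕ x ⊗ p ⊕ w ⊗ y ⊕ x ⊗ w ⊗ c))
          ⊕ x ⊗ (w ⊗ (y ⊖ 𝟙)) ⊗ ((𝟙 ⊕ p) ⊖ c)
    defect = solve 6 (λ b p c w x y →
      b :- (x :^ 2 :+ x :* p :+ w :* (y :- con (+ 1)) :- x :* (w :* (y :- con (+ 1))) :* (con (+ 1) :+ p))
        := (b :+ x :* w :* (y :* c) :+ w :- (x :^ 2 :+ x :* p :+ w :* y :+ x :* w :* c))
           :+ x :* (w :* (y :- con (+ 1))) :* ((con (+ 1) :+ p) :- c)) FPS-ring.refl

  square-root-identity : ∀ w₁ w₂ p → w₂ ≡ X ⊗ w₁ → p ≈ primeForm w₁ p ⊗ (𝟙 ⊕ p) →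
    let S = denominator w₂ ⊗ p ⊖ numerator w₁ w₂ in S ⊗ S ≈ discriminant w₁
  square-root-identity w .(X ⊗ w) p refl functional-equation = begin
    S ⊗ S
      ≈⟨ S²-identity p X w (Y ⊖ 𝟙) ⟩
    discriminant w ⊕ c ⊗ (p ⊖ primeForm w p ⊗ (𝟙 ⊕ p))
      ≈⟨ +-congˡ {discriminant w} (*-congˡ {c} (x≈y⇒x∙y⁻¹≈ε {y = primeForm w p ⊗ (𝟙 ⊕ p)} functional-equation)) ⟩
    discriminant w ⊕ c ⊗ 𝟘  ≈⟨ +-congˡ {discriminant w} (zeroʳ c) ⟩
    discriminant w ⊕ 𝟘      ≈⟨ +-identityʳ _ ⟩
    discriminant w          ∎
    where
    S : FPS
    S = denominator (X ⊗ w) ⊗ p ⊖ numerator w (X ⊗ w)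
    c : FPS
    c = const -[1+ 3 ] ⊗ X ⊗ (𝟙 ⊖ w ⊗ (Y ⊖ 𝟙))
    S²-identity : ∀ (p x w v : FPS) →
      let S = const (+ 2) ⊗ (x ⊗ w ⊗ v ⊖ x) ⊗ p ⊖ (w ⊗ v ⊖ const (+ 2) ⊗ (x ⊗ w) ⊗ v ⊕ x ^^ 2 ⊕ x ⊖ 𝟙)
          Q = w ⊗ v ⊗ (w ⊗ v ⊕ const (+ 4) ⊗ x ⊕ const (+ 2) ⊗ (x ^^ 2 ⊖ x ⊖ 𝟙))
              ⊕ (x ^^ 2 ⊕ x ⊕ 𝟙) ⊗ (x ^^ 2 ⊖ const (+ 3) ⊗ x ⊕ 𝟙)
          B = x ^^ 2 ⊕ x ⊗ p ⊕ w ⊗ v ⊖ x ⊗ (w ⊗ v) ⊗ (𝟙 ⊕ p)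
      in S ⊗ S ≈ Q ⊕ const -[1+ 3 ] ⊗ x ⊗ (𝟙 ⊖ w ⊗ v) ⊗ (p ⊖ B ⊗ (𝟙 ⊕ p))
    S²-identity = solve 4 (λ p x w v →
       let S = con (+ 2) :* (x :* w :* v :- x) :* p :- (w :* v :- con (+ 2) :* (x :* w) :* v :+ x :^ 2 :+ x :- con (+ 1))
           Q = w :* v :* (w :* v :+ con (+ 4) :* x :+ con (+ 2) :* (x :^ 2 :- x :- con (+ 1)))
              :+ (x :^ 2 :+ x :+ con (+ 1)) :* (x :^ 2 :- con (+ 3) :* x :+ con (+ 1))
           B = x :^ 2 :+ x :* p :+ w :* v :- x :* (w :* v) :* (con (+ 1) :+ p)
       in S :* S := Q :+ con -[1+ 3 ] :* x :* (con (+ 1) :- w :* v) :* (p :- B :* (con (+ 1) :+ p))) FPS-ring.refl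


module WordSums where

  open IntegerSums
  open import Algebra.Properties.CommutativeSemigroup ℤP.+-commutativeSemigroup using () renaming (interchange to +-interchange)

  sumList : ∀ {A : Set} → List A → (A → ℤ) → ℤ
  sumList [] f = + 0
  sumList (x ∷ xs) f = f x + sumList xs f

  sumList-cong : ∀ {A : Set} (xs : List A) {f g} → (∀ x → f x ≡ g x) → sumList xs f ≡ sumList xs g
  sumList-cong [] h = refl
  sumList-cong (x ∷ xs) h = cong₂ _+_ (h x) (sumList-cong xs h)

  sumList-+ : ∀ {A : Set} (xs : List A) f g → sumList xs (λ x → f x + g x) ≡ sumList xs f + sumList xs g
  sumList-+ [] f g = refl
  sumList-+ (x ∷ xs) f g = trans (cong (λ z → (f x + g x) + z) (sumList-+ xs f g)) (+-interchange (f x) (g x) (sumList xs f) (sumList xs g))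

  sumList-*ˡ : ∀ {A : Set} (xs : List A) c f → c * sumList xs f ≡ sumList xs (λ x → c * f x)
  sumList-*ˡ [] c f = ℤP.*-zeroʳ c
  sumList-*ˡ (x ∷ xs) c f = trans (ℤP.*-distribˡ-+ c _ _) (cong (λ z → c * f x + z) (sumList-*ˡ xs c f))

  sumList-0 : ∀ {A : Set} (xs : List A) → sumList xs (λ _ → + 0) ≡ + 0
  sumList-0 [] = refl
  sumList-0 (x ∷ xs) = trans (ℤP.+-identityˡ _) (sumList-0 xs)

  sumList-++ : ∀ {A : Set} (xs ys : List A) f → sumList (xs ++ ys) f ≡ sumList xs f + sumList ys f
  sumList-++ [] ys f = sym (ℤP.+-identityˡ _)
  sumList-++ (x ∷ xs) ys f = trans (cong (λ z → f x + z) (sumList-++ xs ys f)) (sym (ℤP.+-assoc (f x) (sumList xs f) (sumList ys f)))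

  sumList-map : ∀ {A B : Set} (g : A → B) (xs : List A) f → sumList (map g xs) f ≡ sumList xs (λ x → f (g x))
  sumList-map g [] f = refl
  sumList-map g (x ∷ xs) f = cong (λ z → f (g x) + z) (sumList-map g xs f)

  sumList-concatMap : ∀ {A B : Set} (g : A → List B) (xs : List A) f → sumList (concatMap g xs) f ≡ sumList xs (λ x → sumList (g x) f)
  sumList-concatMap g [] f = refl
  sumList-concatMap g (x ∷ xs) f = trans (sumList-++ (g x) (concatMap g xs) f) (cong (λ z → sumList (g x) f + z) (sumList-concatMap g xs f))

  sumList-swap : ∀ {A B : Set} (xs : List A) (ys : List B) (F : A → B → ℤ) → sumList xs (λ x → sumList ys (λ y → F x y)) ≡ sumList ys (λ y → sumList xs (λ x → F x y))
  sumList-swap [] ys F = sym (sumList-0 ys)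
  sumList-swap (x ∷ xs) ys F = trans (cong (λ z → sumList ys (F x) + z) (sumList-swap xs ys F)) (sym (sumList-+ ys (F x) (λ y → sumList xs (λ x' → F x' y))))

  sumList-filter : ∀ {A : Set} (b : A → Bool) (xs : List A) f → sumList (filter (λ x → T? (b x)) xs) f ≡ sumList xs (λ x → ι (b x) * f x)
  sumList-filter b [] f = refl
  sumList-filter b (x ∷ xs) f with b x
  ... | true = cong₂ _+_ (sym (ℤP.*-identityˡ (f x))) (sumList-filter b xs f)
  ... | false = trans (sumList-filter b xs f) (sym (ℤP.+-identityˡ _))

  length≡sumList : ∀ {A : Set} (xs : List A) → + length xs ≡ sumList xs (λ _ → + 1)
  length≡sumList [] = refl
  length≡sumList (x ∷ xs) = trans (ℤP.pos-+ 1 (length xs)) (cong (λ z → + 1 + z) (length≡sumList xs))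

  sumWords : List Step → ℕ → (List Step → ℤ) → ℤ
  sumWords a zero f = f []
  sumWords a (suc n) f = sumList a (λ s → sumWords a n (λ w → f (s ∷ w)))

  sumWords-cong : ∀ a n {f g} → (∀ w → length w ≡ n → f w ≡ g w) → sumWords a n f ≡ sumWords a n g
  sumWords-cong a zero h = h [] refl
  sumWords-cong a (suc n) h = sumList-cong a (λ s → sumWords-cong a n (λ w e → h (s ∷ w) (cong suc e)))

  sumWords-+ : ∀ a n f g → sumWords a n (λ w → f w + g w) ≡ sumWords a n f + sumWords a n g
  sumWords-+ a zero f g = refl
  sumWords-+ a (suc n) f g = trans (sumList-cong a (λ s → sumWords-+ a n _ _)) (sumList-+ a _ _)

  sumWords-*ˡ : ∀ a n c f → c * sumWords a n f ≡ sumWords a n (λ w → c * f w)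
  sumWords-*ˡ a zero c f = refl
  sumWords-*ˡ a (suc n) c f = trans (sumList-*ˡ a c _) (sumList-cong a (λ s → sumWords-*ˡ a n c _))

  sumWords-0 : ∀ a n → sumWords a n (λ _ → + 0) ≡ + 0
  sumWords-0 a zero = refl
  sumWords-0 a (suc n) = trans (sumList-cong a (λ s → sumWords-0 a n)) (sumList-0 a)

  sumWords-vanishing : ∀ a n f → (∀ w → length w ≡ n → f w ≡ + 0) → sumWords a n f ≡ + 0
  sumWords-vanishing a n f h = trans (sumWords-cong a n h) (sumWords-0 a n)

  sumWords-++ : ∀ a i l H → sumWords a (i ℕ.+ l) H ≡ sumWords a i (λ u → sumWords a l (λ v → H (u ++ v)))
  sumWords-++ a zero l H = refl
  sumWords-++ a (suc i) l H = sumList-cong a (λ s → sumWords-++ a i l (λ w → H (s ∷ w)))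

  sumList-wordsOver : ∀ a n f → sumList (wordsOver a n) f ≡ sumWords a n f
  sumList-wordsOver a zero f = ℤP.+-identityʳ _
  sumList-wordsOver a (suc n) f = begin
    sumList (concatMap (λ w → map (λ s → s ∷ w) a) (wordsOver a n)) f
      ≡⟨ sumList-concatMap _ (wordsOver a n) f ⟩
    sumList (wordsOver a n) (λ w → sumList (map (λ s → s ∷ w) a) f)
      ≡⟨ sumList-cong (wordsOver a n) (λ w → sumList-map _ a f) ⟩
    sumList (wordsOver a n) (λ w → sumList a (λ s → f (s ∷ w)))
      ≡⟨ sumList-swap (wordsOver a n) a (λ w s → f (s ∷ w)) ⟩
    sumList a (λ s → sumList (wordsOver a n) (λ w → f (s ∷ w)))
      ≡⟨ sumList-cong a (λ s → sumList-wordsOver a n _) ⟩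
    sumList a (λ s → sumWords a n (λ w → f (s ∷ w))) ∎
    where open P.≡-Reasoning

  p≡sumWords : ∀ k n m → + p k n m ≡ sumWords (alphabet n) n (λ w → ι (isAirDyck w) * ι (occurrences (pyramid k) w ≡ᵇ m))
  p≡sumWords k n m = begin
    + length (filter (λ w → T? (occurrences (pyramid k) w ≡ᵇ m)) (𝒜 n)) ≡⟨ length≡sumList (filter (λ w → T? (occurrences (pyramid k) w ≡ᵇ m)) (𝒜 n)) ⟩
    sumList (filter (λ w → T? (occurrences (pyramid k) w ≡ᵇ m)) (𝒜 n)) (λ _ → + 1) ≡⟨ sumList-filter _ (𝒜 n) _ ⟩
    sumList (𝒜 n) (λ w → ι (occurrences (pyramid k) w ≡ᵇ m) * + 1) ≡⟨ sumList-filter _ (words n) _ ⟩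
    sumList (words n) (λ w → ι (isAirDyck w) * (ι (occurrences (pyramid k) w ≡ᵇ m) * + 1)) ≡⟨ sumList-cong (words n) (λ w → cong (λ z → ι (isAirDyck w) * z) (ℤP.*-identityʳ _)) ⟩
    sumList (words n) (λ w → ι (isAirDyck w) * ι (occurrences (pyramid k) w ≡ᵇ m)) ≡⟨ sumList-wordsOver (alphabet n) n _ ⟩
    sumWords (alphabet n) n (λ w → ι (isAirDyck w) * ι (occurrences (pyramid k) w ≡ᵇ m)) ∎
    where open P.≡-Reasoning

  sumWords-Σ≤ : ∀ a n M (F : ℕ → List Step → ℤ) → sumWords a n (λ w → Σ≤ M (λ i → F i w)) ≡ Σ≤ M (λ i → sumWords a n (F i))
  sumWords-Σ≤ a n zero F = refl
  sumWords-Σ≤ a n (suc M) F = trans (sumWords-+ a n (λ w → Σ≤ M (λ i → F i w)) (F (suc M))) (cong (_+ sumWords a n (F (suc M))) (sumWords-Σ≤ a n M F))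

  sumWords-snoc : ∀ a l (H : List Step → ℤ) → sumWords a (suc l) H ≡ sumWords a l (λ w → sumList a (λ s → H (w ++ s ∷ [])))
  sumWords-snoc a l H = trans (cong (λ q → sumWords a q H) (ℕP.+-comm 1 l)) (sumWords-++ a l 1 H)

  take-length-++ : ∀ {A : Set} (u v : List A) → take (length u) (u ++ v) ≡ u
  take-length-++ [] v = refl
  take-length-++ (x ∷ u) v = cong (x ∷_) (take-length-++ u v)

  drop-length-++ : ∀ {A : Set} (u v : List A) → drop (length u) (u ++ v) ≡ v
  drop-length-++ [] v = refl
  drop-length-++ (x ∷ u) v = drop-length-++ u v

  sumWords-splitAt : ∀ a n i → i ≤ n → (G : List Step → List Step → ℤ) →
    sumWords a n (λ w → G (take i w) (drop i w)) ≡ sumWords a i (λ u → sumWords a (n ∸ i) (λ v → G u v))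
  sumWords-splitAt a n i le G = begin
    sumWords a n (λ w → G (take i w) (drop i w)) ≡⟨ cong (λ q → sumWords a q (λ w → G (take i w) (drop i w))) (sym (ℕP.m+[n∸m]≡n le)) ⟩
    sumWords a (i ℕ.+ (n ∸ i)) (λ w → G (take i w) (drop i w)) ≡⟨ sumWords-++ a i (n ∸ i) _ ⟩
    sumWords a i (λ u → sumWords a (n ∸ i) (λ v → G (take i (u ++ v)) (drop i (u ++ v))))
      ≡⟨ sumWords-cong a i (λ u e → sumWords-cong a (n ∸ i) (λ v _ → cong₂ G (trans (cong (λ q → take q (u ++ v)) (sym e)) (take-length-++ u v))
                                                           (trans (cong (λ q → drop q (u ++ v)) (sym e)) (drop-length-++ u v)))) ⟩
    sumWords a i (λ u → sumWords a (n ∸ i) (λ v → G u v)) ∎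
    where open P.≡-Reasoning

  sumWords-product : ∀ a i l (f g : List Step → ℤ) → sumWords a i (λ u → sumWords a l (λ v → f u * g v)) ≡ sumWords a i f * sumWords a l g
  sumWords-product a i l f g = begin
    sumWords a i (λ u → sumWords a l (λ v → f u * g v)) ≡⟨ sumWords-cong a i (λ u _ → sym (sumWords-*ˡ a l (f u) g)) ⟩
    sumWords a i (λ u → f u * sumWords a l g) ≡⟨ sumWords-cong a i (λ u _ → ℤP.*-comm (f u) (sumWords a l g)) ⟩
    sumWords a i (λ u → sumWords a l g * f u) ≡⟨ sym (sumWords-*ˡ a i (sumWords a l g) f) ⟩
    sumWords a l g * sumWords a i f ≡⟨ ℤP.*-comm (sumWords a l g) (sumWords a i f) ⟩
    sumWords a i f * sumWords a l g ∎
    where open P.≡-Reasoning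


module BoolLemmas where

  open import Data.Bool.Properties using (T-≡)
  open import Function.Bundles using (module Equivalence)

  bool-cases : ∀ b → (b ≡ true) ⊎ (b ≡ false)
  bool-cases true = inj₁ refl
  bool-cases false = inj₂ refl

  true≢false : true ≢ false
  true≢false ()

  ≤⇒≤ᵇ≡true : ∀ {m n} → m ≤ n → (m ≤ᵇ n) ≡ true
  ≤⇒≤ᵇ≡true le = Equivalence.to T-≡ (ℕP.≤⇒≤ᵇ le)

  >⇒≤ᵇ≡false : ∀ {m n} → n < m → (m ≤ᵇ n) ≡ false
  >⇒≤ᵇ≡false {m} {n} lt with bool-cases (m ≤ᵇ n)
  ... | inj₂ e = e
  ... | inj₁ e = ⊥-elim (ℕP.<⇒≱ lt (ℕP.≤ᵇ⇒≤ m n (Equivalence.from T-≡ e)))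

  ≤ᵇ≡true⇒≤ : ∀ {m n} → (m ≤ᵇ n) ≡ true → m ≤ n
  ≤ᵇ≡true⇒≤ {m} {n} e = ℕP.≤ᵇ⇒≤ m n (Equivalence.from T-≡ e)

  ≡ᵇ-refl : ∀ n → (n ≡ᵇ n) ≡ true
  ≡ᵇ-refl n = Equivalence.to T-≡ (ℕP.≡⇒≡ᵇ n n refl)

  ≡ᵇ-comm : ∀ m n → (m ≡ᵇ n) ≡ (n ≡ᵇ m)
  ≡ᵇ-comm zero zero = refl
  ≡ᵇ-comm zero (suc n) = refl
  ≡ᵇ-comm (suc m) zero = refl
  ≡ᵇ-comm (suc m) (suc n) = ≡ᵇ-comm m n

  ≢⇒≡ᵇ≡false : ∀ {m n} → m ≢ n → (m ≡ᵇ n) ≡ false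
  ≢⇒≡ᵇ≡false {m} {n} ne with bool-cases (m ≡ᵇ n)
  ... | inj₂ e = e
  ... | inj₁ e = ⊥-elim (ne (ℕP.≡ᵇ⇒≡ m n (Equivalence.from T-≡ e)))

  ≡ᵇ≡true⇒≡ : ∀ {m n} → (m ≡ᵇ n) ≡ true → m ≡ n
  ≡ᵇ≡true⇒≡ {m} {n} e = ℕP.≡ᵇ⇒≡ m n (Equivalence.from T-≡ e)

  ∧≡true⇒ˡ : ∀ {a b} → (a ∧ b) ≡ true → a ≡ true
  ∧≡true⇒ˡ {true} e = refl

  ∧≡true⇒ʳ : ∀ {a b} → (a ∧ b) ≡ true → b ≡ true
  ∧≡true⇒ʳ {true} e = e

  ιℕ : Bool → ℕ
  ιℕ b = if b then 1 else 0

  ∧∧-zeroʳ : ∀ a b → (a ∧ b ∧ false) ≡ false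
  ∧∧-zeroʳ a b = trans (cong (a ∧_) (∧-zeroʳ b)) (∧-zeroʳ a)

  ∧∧≡true : ∀ {a b c} → a ≡ true → b ≡ true → c ≡ true → (a ∧ b ∧ c) ≡ true
  ∧∧≡true refl refl refl = refl

  suc-∸ : ∀ {x h} → x ≤ h → suc h ∸ x ≡ suc (h ∸ x)
  suc-∸ {x} {h} le = ℕP.+-∸-assoc 1 le

  ≡ᵇ-via-≤ᵇ : ∀ j h → (suc j ≡ᵇ h) ≡ ((suc j ≤ᵇ h) ∧ ((h ∸ suc j) ≡ᵇ 0))
  ≡ᵇ-via-≤ᵇ j h with ℕP.<-cmp (suc j) h
  ... | tri< lt _ _ = trans (≢⇒≡ᵇ≡false (ℕP.<⇒≢ lt)) (sym (trans (cong (_∧ ((h ∸ suc j) ≡ᵇ 0)) (≤⇒≤ᵇ≡true (ℕP.<⇒≤ lt)))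
                        (≢⇒≡ᵇ≡false (λ e → ℕP.<⇒≢ (ℕP.m<n⇒0<n∸m lt) (sym e)))))
  ... | tri≈ _ refl _ = trans (≡ᵇ-refl (suc j)) (sym (trans (cong (_∧ ((suc j ∸ suc j) ≡ᵇ 0)) (≤⇒≤ᵇ≡true {suc j} {suc j} ℕP.≤-refl)) (cong (_≡ᵇ 0) (ℕP.n∸n≡0 j))))
  ... | tri> _ _ gt = trans (≢⇒≡ᵇ≡false (λ e → ℕP.<⇒≢ gt (sym e))) (sym (cong (_∧ ((h ∸ suc j) ≡ᵇ 0)) (>⇒≤ᵇ≡false gt)))


module Pyramids where

  open BoolLemmas

  isUᵏ : ℕ → List Step → Bool
  isUᵏ zero [] = true
  isUᵏ zero (_ ∷ _) = false
  isUᵏ (suc k) [] = false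
  isUᵏ (suc k) (U ∷ w) = isUᵏ k w
  isUᵏ (suc k) (D _ ∷ w) = false

  isUᵏ-sound : ∀ k x → isUᵏ k x ≡ true → x ≡ replicate k U
  isUᵏ-sound zero [] e = refl
  isUᵏ-sound (suc k) (U ∷ x) e = cong (U ∷_) (isUᵏ-sound k x e)

  isUᵏ-length : ∀ k x → isUᵏ k x ≡ true → length x ≡ k
  isUᵏ-length k x e = trans (cong length (isUᵏ-sound k x e)) (LP.length-replicate k)

  isUᵏ-replicate : ∀ k → isUᵏ k (replicate k U) ≡ true
  isUᵏ-replicate zero = refl
  isUᵏ-replicate (suc k) = isUᵏ-replicate k

  isUᵏ-wrongLength : ∀ k x → length x ≢ k → isUᵏ k x ≡ false
  isUᵏ-wrongLength k x ne with bool-cases (isUᵏ k x)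
  ... | inj₂ e = e
  ... | inj₁ e = ⊥-elim (ne (isUᵏ-length k x e))

  endsWithUᵏ : ℕ → List Step → Bool
  endsWithUᵏ k [] = isUᵏ k []
  endsWithUᵏ k (s ∷ w) = isUᵏ k (s ∷ w) ∨ endsWithUᵏ k w

  endsWithUᵏ-short : ∀ k w → length w < k → endsWithUᵏ k w ≡ false
  endsWithUᵏ-short k [] lt = isUᵏ-wrongLength k [] (λ e → ℕP.<⇒≢ lt e)
  endsWithUᵏ-short k (s ∷ w) lt = trans (cong (_∨ endsWithUᵏ k w) (isUᵏ-wrongLength k (s ∷ w) (λ e → ℕP.<⇒≢ lt e)))
                                 (endsWithUᵏ-short k w (ℕP.<-trans (ℕP.n<1+n _) lt))

  endsWithUᵏ-++ : ∀ k β γ → length γ ≡ k → endsWithUᵏ k (β ++ γ) ≡ isUᵏ k γ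
  endsWithUᵏ-++ k [] [] e = refl
  endsWithUᵏ-++ k [] (c ∷ γ) e = trans (cong (isUᵏ k (c ∷ γ) ∨_) (endsWithUᵏ-short k γ (subst (length γ <_) e (ℕP.n<1+n _)))) (∨-identityʳ _)
  endsWithUᵏ-++ k (b ∷ β) γ e = trans (cong (_∨ endsWithUᵏ k (β ++ γ)) (isUᵏ-wrongLength k (b ∷ β ++ γ) ne)) (endsWithUᵏ-++ k β γ e)
    where
    ne : length (b ∷ β ++ γ) ≢ k
    ne e2 = ℕP.<⇒≢ (subst (_< length (b ∷ β ++ γ)) e (ℕP.≤-trans (s≤s (ℕP.m≤n+m (length γ) (length β))) (ℕP.≤-reflexive (cong suc (sym (LP.length-++ β {γ})))))) (sym e2)

  endsWithUᵏ-sound : ∀ k w → endsWithUᵏ k w ≡ true → Σ (List Step) λ β → w ≡ β ++ replicate k U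
  endsWithUᵏ-sound k [] e = [] , isUᵏ-sound k [] e
  endsWithUᵏ-sound k (s ∷ w) e with bool-cases (isUᵏ k (s ∷ w))
  ... | inj₁ e1 = [] , isUᵏ-sound k (s ∷ w) e1
  ... | inj₂ e1 with endsWithUᵏ-sound k w (trans (sym (cong (_∨ endsWithUᵏ k w) e1)) e)
  ...   | β , eq = s ∷ β , cong (s ∷_) eq

  occ : ℕ → List Step → ℕ
  occ k w = occurrences (pyramid k) w

  isPrefix-pyramid-snocD : ∀ j k v x → ιℕ (isPrefix (replicate j U ++ D k ∷ []) (v ++ D x ∷ []))
         ≡ ιℕ (isPrefix (replicate j U ++ D k ∷ []) v) ℕ.+ ιℕ (isUᵏ j v ∧ (k ≡ᵇ x))
  isPrefix-pyramid-snocD zero k [] x with k ≡ᵇ x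
  ... | true = refl
  ... | false = refl
  isPrefix-pyramid-snocD zero k (c ∷ v) x = sym (ℕP.+-identityʳ _)
  isPrefix-pyramid-snocD (suc j) k [] x = refl
  isPrefix-pyramid-snocD (suc j) k (U ∷ v) x = isPrefix-pyramid-snocD j k v x
  isPrefix-pyramid-snocD (suc j) k (D y ∷ v) x = refl

  ιℕ-∧-∨ : ∀ u e c → (u ≡ true → e ≡ false) → ιℕ (u ∧ c) ℕ.+ ιℕ (e ∧ c) ≡ ιℕ ((u ∨ e) ∧ c)
  ιℕ-∧-∨ false e c _ = refl
  ιℕ-∧-∨ true e c u⇒¬e rewrite u⇒¬e refl = ℕP.+-identityʳ (ιℕ c)

  isUᵏ⇒¬endsWithUᵏ-tail : ∀ k s w → isUᵏ k (s ∷ w) ≡ true → endsWithUᵏ k w ≡ false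
  isUᵏ⇒¬endsWithUᵏ-tail k s w e = endsWithUᵏ-short k w (subst (length w <_) (isUᵏ-length k (s ∷ w) e) (ℕP.n<1+n _))

  occ-snocD : ∀ k' w x → occ (suc k') (w ++ D x ∷ []) ≡ occ (suc k') w ℕ.+ ιℕ (endsWithUᵏ (suc k') w ∧ (suc k' ≡ᵇ x))
  occ-snocD k' [] x = refl
  occ-snocD k' (s ∷ w) x = begin
    ιℕ (isPrefix (pyramid K) (s ∷ w ++ D x ∷ [])) ℕ.+ occ K (w ++ D x ∷ [])
      ≡⟨ cong₂ ℕ._+_ (isPrefix-pyramid-snocD K K (s ∷ w) x) (occ-snocD k' w x) ⟩
    (a ℕ.+ ιℕ (isUᵏ K (s ∷ w) ∧ c)) ℕ.+ (occ K w ℕ.+ ιℕ (endsWithUᵏ K w ∧ c))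
      ≡⟨ +-interchange a _ (occ K w) _ ⟩
    (a ℕ.+ occ K w) ℕ.+ (ιℕ (isUᵏ K (s ∷ w) ∧ c) ℕ.+ ιℕ (endsWithUᵏ K w ∧ c))
      ≡⟨ cong ((a ℕ.+ occ K w) ℕ.+_) (ιℕ-∧-∨ (isUᵏ K (s ∷ w)) (endsWithUᵏ K w) c (isUᵏ⇒¬endsWithUᵏ-tail K s w)) ⟩
    (a ℕ.+ occ K w) ℕ.+ ιℕ ((isUᵏ K (s ∷ w) ∨ endsWithUᵏ K w) ∧ c) ∎
    where
    open P.≡-Reasoning
    open import Algebra.Properties.CommutativeSemigroup ℕP.+-commutativeSemigroup using () renaming (interchange to +-interchange)
    K : ℕ
    K = suc k'
    a : ℕ
    a = ιℕ (isPrefix (pyramid K) (s ∷ w))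
    c : Bool
    c = K ≡ᵇ x

  isPrefix-pyramid-[] : ∀ j k → isPrefix (replicate j U ++ D k ∷ []) [] ≡ false
  isPrefix-pyramid-[] zero k = refl
  isPrefix-pyramid-[] (suc j) k = refl

  isPrefix-pyramid-cutAfterD : ∀ j k s' x v → isPrefix (replicate j U ++ D k ∷ []) (s' ++ D x ∷ v) ≡ isPrefix (replicate j U ++ D k ∷ []) (s' ++ D x ∷ [])
  isPrefix-pyramid-cutAfterD zero k [] x v = refl
  isPrefix-pyramid-cutAfterD zero k (c ∷ s') x v = refl
  isPrefix-pyramid-cutAfterD (suc j) k [] x v = refl
  isPrefix-pyramid-cutAfterD (suc j) k (U ∷ s') x v = isPrefix-pyramid-cutAfterD j k s' x v
  isPrefix-pyramid-cutAfterD (suc j) k (D y ∷ s') x v = refl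

  occ-++-afterD : ∀ k' u x v → occ (suc k') (u ++ D x ∷ v) ≡ occ (suc k') (u ++ D x ∷ []) ℕ.+ occ (suc k') v
  occ-++-afterD k' [] x v = cong (ℕ._+ occ (suc k') v) (trans (cong ιℕ (isPrefix-pyramid-cutAfterD (suc k') (suc k') [] x v)) (sym (ℕP.+-identityʳ _)))
  occ-++-afterD k' (c ∷ u) x v =
    trans (cong₂ ℕ._+_ (cong ιℕ (isPrefix-pyramid-cutAfterD (suc k') (suc k') (c ∷ u) x v)) (occ-++-afterD k' u x v))
          (sym (ℕP.+-assoc (ιℕ (isPrefix (pyramid (suc k')) (c ∷ u ++ D x ∷ []))) (occ (suc k') (u ++ D x ∷ [])) (occ (suc k') v)))

  isPrefix-pyramid-snocU : ∀ j k v → isPrefix (replicate j U ++ D k ∷ []) (v ++ U ∷ []) ≡ isPrefix (replicate j U ++ D k ∷ []) v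
  isPrefix-pyramid-snocU zero k [] = refl
  isPrefix-pyramid-snocU zero k (c ∷ v) = refl
  isPrefix-pyramid-snocU (suc j) k [] = isPrefix-pyramid-[] j k
  isPrefix-pyramid-snocU (suc j) k (U ∷ v) = isPrefix-pyramid-snocU j k v
  isPrefix-pyramid-snocU (suc j) k (D y ∷ v) = refl

  occ-snocU : ∀ k' w → occ (suc k') (w ++ U ∷ []) ≡ occ (suc k') w
  occ-snocU k' [] = cong (λ z → ιℕ z ℕ.+ 0) (isPrefix-pyramid-[] k' (suc k'))
  occ-snocU k' (c ∷ w) = cong₂ ℕ._+_ (cong ιℕ (isPrefix-pyramid-snocU (suc k') (suc k') (c ∷ w))) (occ-snocU k' w)

  occ-++-Us : ∀ k' w n → occ (suc k') (w ++ replicate n U) ≡ occ (suc k') w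
  occ-++-Us k' w zero = cong (occ (suc k')) (LP.++-identityʳ w)
  occ-++-Us k' w (suc n) = trans (cong (occ (suc k')) (sym (LP.++-assoc w (U ∷ []) (replicate n U))))
                           (trans (occ-++-Us k' (w ++ U ∷ []) n) (occ-snocU k' w))

  occ-++-pyramid : ∀ k' β → occ (suc k') (β ++ replicate (suc k') U ++ D (suc k') ∷ []) ≡ suc (occ (suc k') β)
  occ-++-pyramid k' β = begin
    occ K (β ++ replicate K U ++ D K ∷ []) ≡⟨ cong (occ K) (sym (LP.++-assoc β (replicate K U) (D K ∷ []))) ⟩
    occ K ((β ++ replicate K U) ++ D K ∷ []) ≡⟨ occ-snocD k' (β ++ replicate K U) K ⟩
    occ K (β ++ replicate K U) ℕ.+ ιℕ (endsWithUᵏ K (β ++ replicate K U) ∧ (K ≡ᵇ K))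
      ≡⟨ cong₂ (λ z1 z2 → z1 ℕ.+ ιℕ (z2 ∧ (K ≡ᵇ K))) (occ-++-Us k' β K) (trans (endsWithUᵏ-++ K β (replicate K U) (LP.length-replicate K)) (isUᵏ-replicate K)) ⟩
    occ K β ℕ.+ ιℕ (K ≡ᵇ K) ≡⟨ cong (λ z → occ K β ℕ.+ ιℕ z) (≡ᵇ-refl K) ⟩
    occ K β ℕ.+ 1 ≡⟨ ℕP.+-comm _ 1 ⟩
    suc (occ K β) ∎
    where
    open P.≡-Reasoning
    K : ℕ
    K = suc k'


module PathValidity where

  open BoolLemmas
  open Pyramids

  -- Like go, but the path may reach height 0 only at its last step: a prime path.
  goPrime : ℕ → Bool → List Step → Bool
  goPrime h _ [] = false
  goPrime h b (U ∷ w) = goPrime (suc h) false w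
  goPrime h true (D k ∷ w) = false
  goPrime h false (D k ∷ []) = (1 ≤ᵇ k) ∧ (k ≡ᵇ h)
  goPrime h false (D k ∷ (s ∷ w)) = (1 ≤ᵇ k) ∧ (suc k ≤ᵇ h) ∧ goPrime (h ∸ k) true (s ∷ w)

  goPrime-D∷nonempty : ∀ h x r → r ≢ [] → goPrime h false (D x ∷ r) ≡ (1 ≤ᵇ x) ∧ (suc x ≤ᵇ h) ∧ goPrime (h ∸ x) true r
  goPrime-D∷nonempty h x [] ne = ⊥-elim (ne refl)
  goPrime-D∷nonempty h x (s ∷ r) ne = refl

  ++-∷-nonempty : ∀ {A : Set} (w : List A) c r → w ++ c ∷ r ≢ []
  ++-∷-nonempty [] c r ()
  ++-∷-nonempty (x ∷ w) c r ()

  goPrime-D∷-false : ∀ h x r → r ≢ [] → goPrime (h ∸ x) true r ≡ false → goPrime h false (D x ∷ r) ≡ false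
  goPrime-D∷-false h x r r≢[] rest = trans (goPrime-D∷nonempty h x r r≢[])
    (trans (cong (λ q → (1 ≤ᵇ x) ∧ (suc x ≤ᵇ h) ∧ q) rest) (∧∧-zeroʳ (1 ≤ᵇ x) (suc x ≤ᵇ h)))

  go-snocU : ∀ h b w → go h b (w ++ U ∷ []) ≡ false
  go-snocU h b [] = refl
  go-snocU h b (U ∷ w) = go-snocU (suc h) false w
  go-snocU h true (D x ∷ w) = refl
  go-snocU h false (D x ∷ w) = trans (cong (λ z → (1 ≤ᵇ x) ∧ (x ≤ᵇ h) ∧ z) (go-snocU (h ∸ x) true w)) (∧∧-zeroʳ (1 ≤ᵇ x) (x ≤ᵇ h))

  goPrime-snocU : ∀ h b w → goPrime h b (w ++ U ∷ []) ≡ false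
  goPrime-snocU h b [] = refl
  goPrime-snocU h b (U ∷ w) = goPrime-snocU (suc h) false w
  goPrime-snocU h true (D x ∷ w) = refl
  goPrime-snocU h false (D x ∷ w) = goPrime-D∷-false h x (w ++ U ∷ []) (++-∷-nonempty w U []) (goPrime-snocU (h ∸ x) true w)

  goPrime-snocDD : ∀ h b w₀ y z → goPrime h b (w₀ ++ D y ∷ D z ∷ []) ≡ false
  goPrime-snocDD h true [] y z = refl
  goPrime-snocDD h false [] y z = ∧∧-zeroʳ (1 ≤ᵇ y) (suc y ≤ᵇ h)
  goPrime-snocDD h b (U ∷ w₀) y z = goPrime-snocDD (suc h) false w₀ y z
  goPrime-snocDD h true (D x ∷ w₀) y z = refl
  goPrime-snocDD h false (D x ∷ w₀) y z = goPrime-D∷-false h x (w₀ ++ D y ∷ D z ∷ []) (++-∷-nonempty w₀ _ _) (goPrime-snocDD (h ∸ x) true w₀ y z)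

  goPrime-snocUD₁ : ∀ w₀ h b → goPrime (suc h) b (w₀ ++ U ∷ D 1 ∷ []) ≡ false
  goPrime-snocUD₁ [] h b = refl
  goPrime-snocUD₁ (U ∷ w₀) h b = goPrime-snocUD₁ w₀ (suc h) false
  goPrime-snocUD₁ (D x ∷ w₀) h true = refl
  goPrime-snocUD₁ (D x ∷ w₀) h false = trans (goPrime-D∷nonempty (suc h) x (w₀ ++ U ∷ D 1 ∷ []) (++-∷-nonempty w₀ _ _)) after-D
    where
    after-D : ((1 ≤ᵇ x) ∧ (suc x ≤ᵇ suc h) ∧ goPrime (suc h ∸ x) true (w₀ ++ U ∷ D 1 ∷ [])) ≡ false
    after-D with bool-cases (suc x ≤ᵇ suc h)
    ... | inj₂ e = trans (cong (λ q → (1 ≤ᵇ x) ∧ q ∧ goPrime (suc h ∸ x) true (w₀ ++ U ∷ D 1 ∷ [])) e) (∧-zeroʳ _)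
    ... | inj₁ e = trans (cong (λ q → (1 ≤ᵇ x) ∧ (suc x ≤ᵇ suc h) ∧ q)
                     (trans (cong (λ hh → goPrime hh true (w₀ ++ U ∷ D 1 ∷ [])) (suc-∸ {x} {h} (ℕP.≤-pred (≤ᵇ≡true⇒≤ {suc x} {suc h} e)))) (goPrime-snocUD₁ w₀ (h ∸ x) true)))
                     (∧∧-zeroʳ (1 ≤ᵇ x) (suc x ≤ᵇ suc h))

  goPrime-snocD₁⇒[] : ∀ h b w → goPrime (suc h) b (w ++ D 1 ∷ []) ≡ true → w ≡ []
  goPrime-snocD₁⇒[] h b w e with initLast w
  ... | [] = refl
  ... | w₀ ∷ʳ′ U = ⊥-elim (true≢false (trans (sym e) (trans (cong (goPrime (suc h) b) (LP.++-assoc w₀ (U ∷ []) (D 1 ∷ []))) (goPrime-snocUD₁ w₀ h b))))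
  ... | w₀ ∷ʳ′ D y = ⊥-elim (true≢false (trans (sym e) (trans (cong (goPrime (suc h) b) (LP.++-assoc w₀ (D y ∷ []) (D 1 ∷ []))) (goPrime-snocDD (suc h) b w₀ y 1))))

  goPrime-raiseLastDown : ∀ h b w j' → goPrime (suc h) b (w ++ D (suc (suc j')) ∷ []) ≡ go h b (w ++ D (suc j') ∷ [])
  goPrime-raiseLastDown h true [] j' = refl
  goPrime-raiseLastDown h false [] j' = ≡ᵇ-via-≤ᵇ j' h
  goPrime-raiseLastDown h b (U ∷ w) j' = goPrime-raiseLastDown (suc h) false w j'
  goPrime-raiseLastDown h true (D x ∷ w) j' = refl
  goPrime-raiseLastDown h false (D zero ∷ w) j' = trans (goPrime-D∷nonempty (suc h) zero (w ++ D (suc (suc j')) ∷ []) (++-∷-nonempty w _ _)) refl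
  goPrime-raiseLastDown h false (D (suc x') ∷ w) j' = trans (goPrime-D∷nonempty (suc h) (suc x') (w ++ D (suc (suc j')) ∷ []) (++-∷-nonempty w _ _)) after-D
    where
    after-D : ((1 ≤ᵇ suc x') ∧ (suc (suc x') ≤ᵇ suc h) ∧ goPrime (suc h ∸ suc x') true (w ++ D (suc (suc j')) ∷ []))
          ≡ ((1 ≤ᵇ suc x') ∧ (suc x' ≤ᵇ h) ∧ go (h ∸ suc x') true (w ++ D (suc j') ∷ []))
    after-D with bool-cases (suc x' ≤ᵇ h)
    ... | inj₂ e = trans (cong (λ q → q ∧ goPrime (h ∸ x') true (w ++ D (suc (suc j')) ∷ [])) e) (sym (cong (λ q → q ∧ go (h ∸ suc x') true (w ++ D (suc j') ∷ [])) e))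
    ... | inj₁ e = cong (λ q → (suc x' ≤ᵇ h) ∧ q)
          (trans (cong (λ hh → goPrime hh true (w ++ D (suc (suc j')) ∷ [])) (suc-∸ {suc x'} {h} (≤ᵇ≡true⇒≤ {suc x'} {h} e))) (goPrime-raiseLastDown (h ∸ suc x') true w j'))

  go-Us : ∀ h i x → go h false (replicate i U ++ x) ≡ go (h ℕ.+ i) false x
  go-Us h zero x = cong (λ q → go q false x) (sym (ℕP.+-identityʳ h))
  go-Us h (suc i) x = trans (go-Us (suc h) i x) (cong (λ q → go q false x) (sym (ℕP.+-suc h i)))

  go-++-pyramid : ∀ h b β k' → go h b (β ++ replicate (suc k') U ++ D (suc k') ∷ []) ≡ go h b β
  go-++-pyramid h b [] k' = begin
    go (suc h) false (replicate k' U ++ D (suc k') ∷ []) ≡⟨ go-Us (suc h) k' _ ⟩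
    go (suc h ℕ.+ k') false (D (suc k') ∷ []) ≡⟨⟩
    (suc k' ≤ᵇ suc (h ℕ.+ k')) ∧ ((suc (h ℕ.+ k') ∸ suc k') ≡ᵇ 0)
      ≡⟨ cong₂ (λ a c → a ∧ (c ≡ᵇ 0)) (≤⇒≤ᵇ≡true {suc k'} {suc (h ℕ.+ k')} (s≤s (ℕP.m≤n+m k' h))) (ℕP.m+n∸n≡m h k') ⟩
    (h ≡ᵇ 0) ∎
    where open P.≡-Reasoning
  go-++-pyramid h b (U ∷ β) k' = go-++-pyramid (suc h) false β k'
  go-++-pyramid h true (D x ∷ β) k' = refl
  go-++-pyramid h false (D x ∷ β) k' = cong (λ q → (1 ≤ᵇ x) ∧ (x ≤ᵇ h) ∧ q) (go-++-pyramid (h ∸ x) true β k')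

  ==ₛ-sound : ∀ a b → (a ==ₛ b) ≡ true → a ≡ b
  ==ₛ-sound U U e = refl
  ==ₛ-sound (D x) (D y) e = cong D (≡ᵇ≡true⇒≡ e)

  isPrefix-sound : ∀ p x → isPrefix p x ≡ true → Σ (List Step) λ r → x ≡ p ++ r
  isPrefix-sound [] x e = x , refl
  isPrefix-sound (a ∷ p) (b ∷ x) e with isPrefix-sound p x (∧≡true⇒ʳ {a ==ₛ b} e)
  ... | r , eq = r , cong₂ _∷_ (sym (==ₛ-sound a b (∧≡true⇒ˡ {a ==ₛ b} e))) eq

  go-suffix : ∀ h b u v → go h b (u ++ v) ≡ true → Σ ℕ λ h' → Σ Bool λ b' → go h' b' v ≡ true
  go-suffix h b [] v e = h , b , e
  go-suffix h b (U ∷ u) v e = go-suffix (suc h) false u v e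
  go-suffix h false (D x ∷ u) v e = go-suffix (h ∸ x) true u v (∧≡true⇒ʳ {x ≤ᵇ h} (∧≡true⇒ʳ {1 ≤ᵇ x} e))

  ¬isPrefix-pyramid-raised : ∀ k' w j → go 0 false (w ++ D j ∷ []) ≡ true → isPrefix (pyramid (suc k')) (U ∷ w) ≡ false
  ¬isPrefix-pyramid-raised k' w j e with bool-cases (isPrefix (replicate k' U ++ D (suc k') ∷ []) w)
  ... | inj₂ e2 = e2
  ... | inj₁ e2 with isPrefix-sound (replicate k' U ++ D (suc k') ∷ []) w e2
  ...   | r , refl = ⊥-elim (true≢false (trans (sym e) starts-below-zero))
    where
    starts-below-zero : go 0 false (((replicate k' U ++ D (suc k') ∷ []) ++ r) ++ D j ∷ []) ≡ false
    starts-below-zero = begin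
      go 0 false (((replicate k' U ++ D (suc k') ∷ []) ++ r) ++ D j ∷ [])
        ≡⟨ cong (go 0 false) (trans (LP.++-assoc (replicate k' U ++ D (suc k') ∷ []) r (D j ∷ [])) (LP.++-assoc (replicate k' U) (D (suc k') ∷ []) (r ++ D j ∷ []))) ⟩
      go 0 false (replicate k' U ++ D (suc k') ∷ (r ++ D j ∷ [])) ≡⟨ go-Us 0 k' _ ⟩
      (1 ≤ᵇ suc k') ∧ (suc k' ≤ᵇ k') ∧ go (k' ∸ suc k') true (r ++ D j ∷ [])
        ≡⟨ cong (λ q → q ∧ go (k' ∸ suc k') true (r ++ D j ∷ [])) (>⇒≤ᵇ≡false {suc k'} {k'} ℕP.≤-refl) ⟩
      false ∎
      where open P.≡-Reasoning

  endsWithUᵏ⇒k≤lastDown : ∀ k' w j → go 0 false (w ++ D j ∷ []) ≡ true → endsWithUᵏ (suc k') w ≡ true → suc k' ≤ j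
  endsWithUᵏ⇒k≤lastDown k' w j e s with endsWithUᵏ-sound (suc k') w s
  ... | β , refl with go-suffix 0 false β (replicate (suc k') U ++ D j ∷ []) (trans (cong (go 0 false) (sym (LP.++-assoc β (replicate (suc k') U) (D j ∷ [])))) e)
  ...   | h' , b' , e2 = lands-at-0 (trans (sym (go-Us (suc h') k' (D j ∷ []))) e2)
    where
    lands-at-0 : go (suc h' ℕ.+ k') false (D j ∷ []) ≡ true → suc k' ≤ j
    lands-at-0 e3 = ℕP.≤-trans (s≤s (ℕP.m≤n+m k' h')) (ℕP.m∸n≡0⇒m≤n (≡ᵇ≡true⇒≡ {suc h' ℕ.+ k' ∸ j} {0} (∧≡true⇒ʳ {j ≤ᵇ suc h' ℕ.+ k'} (∧≡true⇒ʳ {1 ≤ᵇ j} e3))))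

  goPrime⇒go : ∀ h b w → goPrime h b w ≡ true → go h b w ≡ true
  goPrime⇒go h b (U ∷ w) e = goPrime⇒go (suc h) false w e
  goPrime⇒go h false (D k ∷ []) e with ≡ᵇ≡true⇒≡ {k} {h} (∧≡true⇒ʳ {1 ≤ᵇ k} e)
  ... | refl = ∧∧≡true (∧≡true⇒ˡ {1 ≤ᵇ k} e) (≤⇒≤ᵇ≡true {k} {k} ℕP.≤-refl) (trans (cong (_≡ᵇ 0) (ℕP.n∸n≡0 k)) refl)
  goPrime⇒go h false (D k ∷ (s ∷ w)) e =
    ∧∧≡true (∧≡true⇒ˡ {1 ≤ᵇ k} e)
            (≤⇒≤ᵇ≡true (ℕP.<⇒≤ (≤ᵇ≡true⇒≤ {suc k} {h} (∧≡true⇒ˡ {suc k ≤ᵇ h} (∧≡true⇒ʳ {1 ≤ᵇ k} e)))))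
            (goPrime⇒go (h ∸ k) true (s ∷ w) (∧≡true⇒ʳ {suc k ≤ᵇ h} (∧≡true⇒ʳ {1 ≤ᵇ k} e)))

  downStep-bound : ∀ h b w x → go h b w ≡ true → D x ∈ w → x ≤ h ℕ.+ length w
  downStep-bound h b (U ∷ w) x e (there i) = ℕP.≤-trans (downStep-bound (suc h) false w x e i) (ℕP.≤-reflexive (sym (ℕP.+-suc h (length w))))
  downStep-bound h false (D y ∷ w) x e (here refl) = ℕP.≤-trans (≤ᵇ≡true⇒≤ {y} {h} (∧≡true⇒ˡ {y ≤ᵇ h} (∧≡true⇒ʳ {1 ≤ᵇ y} e))) (ℕP.m≤m+n h _)
  downStep-bound h false (D y ∷ w) x e (there i) = ℕP.≤-trans (downStep-bound (h ∸ y) true w x (∧≡true⇒ʳ {y ≤ᵇ h} (∧≡true⇒ʳ {1 ≤ᵇ y} e)) i)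
     (ℕP.≤-trans (ℕP.+-monoˡ-≤ (length w) (ℕP.m∸n≤m h y)) (ℕP.+-monoʳ-≤ h (ℕP.n≤1+n _)))
  downStep-bound h true (D y ∷ w) x () i

  go₀-flag-irrelevant : ∀ v → go 0 true v ≡ go 0 false v
  go₀-flag-irrelevant [] = refl
  go₀-flag-irrelevant (U ∷ v) = refl
  go₀-flag-irrelevant (D zero ∷ v) = refl
  go₀-flag-irrelevant (D (suc k) ∷ v) = refl


module FirstReturn where

  open IntegerSums
  open BoolLemmas
  open Pyramids
  open PathValidity

  firstReturnSum : ℕ → Bool → List Step → ℤ
  firstReturnSum h b w = Σ≤ (length w) (λ i → ι (goPrime h b (take i w)) * ι (go 0 false (drop i w)))

  firstReturnSum-∷ : ∀ h b s w →
    firstReturnSum h b (s ∷ w) ≡ Σ≤ (length w) (λ i → ι (goPrime h b (s ∷ take i w)) * ι (go 0 false (drop i w)))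
  firstReturnSum-∷ h b s w = trans (Σ≤-shift (length w) _) (ℤP.+-identityˡ _)

  firstReturnSum-D∷ : ∀ k s w h →
    firstReturnSum (suc h) false (D (suc k) ∷ s ∷ w)
      ≡ ι (k ≡ᵇ h) * ι (go 0 false (s ∷ w))
        + Σ≤ (length w) (λ i → ι (goPrime (suc h) false (D (suc k) ∷ s ∷ take i w)) * ι (go 0 false (drop i w)))
  firstReturnSum-D∷ k s w h = trans (firstReturnSum-∷ (suc h) false (D (suc k)) (s ∷ w)) (Σ≤-shift (length w) _)

  goPrime-D₀ : ∀ h x → goPrime h false (D zero ∷ x) ≡ false
  goPrime-D₀ h [] = refl
  goPrime-D₀ h (s ∷ x) = refl

  go-firstReturn-D : ∀ k s w h → (∀ h b → ι (go (suc h) b (s ∷ w)) ≡ firstReturnSum (suc h) b (s ∷ w)) →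
    ι (go (suc h) false (D (suc k) ∷ s ∷ w)) ≡ firstReturnSum (suc h) false (D (suc k) ∷ s ∷ w)

  go-firstReturn : ∀ w h b → ι (go (suc h) b w) ≡ firstReturnSum (suc h) b w
  go-firstReturn [] h b = refl
  go-firstReturn (U ∷ w) h b = trans (go-firstReturn w (suc h) false) (sym (trans (Σ≤-shift (length w) _) (ℤP.+-identityˡ _)))
  go-firstReturn (D k ∷ w) h true = sym (trans (Σ≤-shift (length w) _) (trans (ℤP.+-identityˡ _) (Σ≤-0 (length w))))
  go-firstReturn (D zero ∷ w) h false = sym (trans (Σ≤-shift (length w) _) (trans (ℤP.+-identityˡ _)
     (Σ≤-vanishing (length w) _ (λ i _ → cong (λ q → ι q * ι (go 0 false (drop i w))) (goPrime-D₀ (suc h) (take i w))))))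
  go-firstReturn (D (suc k) ∷ []) h false = trans (cong ι (sym (≡ᵇ-via-≤ᵇ k (suc h)))) (sym (trans (ℤP.+-identityˡ _) (ℤP.*-identityʳ (ι (k ≡ᵇ h)))))
  go-firstReturn (D (suc k) ∷ (s ∷ w)) h false = go-firstReturn-D k s w h (go-firstReturn (s ∷ w))

  go-firstReturn-D k s w h IH with ℕP.<-cmp k h
  ... | tri< k<h _ _ = begin
    ι ((k ℕ.<ᵇ suc h) ∧ go (h ∸ k) true (s ∷ w))
      ≡⟨ cong ι (cong₂ (λ q h' → q ∧ go h' true (s ∷ w)) (≤⇒≤ᵇ≡true (s≤s (ℕP.<⇒≤ k<h))) (suc-∸ k<h)) ⟩
    ι (go (suc (h ∸ suc k)) true (s ∷ w))
      ≡⟨ trans (IH (h ∸ suc k) true) (firstReturnSum-∷ _ true s w) ⟩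
    Σ≤ (length w) (λ i → ι (goPrime (suc (h ∸ suc k)) true (s ∷ take i w)) * ι (go 0 false (drop i w)))
      ≡⟨ Σ≤-cong (length w) (λ i → cong (λ q → ι q * ι (go 0 false (drop i w))) (sym (below-h (s ∷ take i w)))) ⟩
    Σ≤ (length w) (λ i → ι (goPrime (suc h) false (D (suc k) ∷ s ∷ take i w)) * ι (go 0 false (drop i w)))
      ≡⟨ sym (ℤP.+-identityˡ _) ⟩
    ι false * ι (go 0 false (s ∷ w)) + Σ≤ (length w) (λ i → ι (goPrime (suc h) false (D (suc k) ∷ s ∷ take i w)) * ι (go 0 false (drop i w)))
      ≡⟨ cong (λ q → ι q * ι (go 0 false (s ∷ w)) + Σ≤ (length w) (λ i → ι (goPrime (suc h) false (D (suc k) ∷ s ∷ take i w)) * ι (go 0 false (drop i w))))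
           (sym (≢⇒≡ᵇ≡false (ℕP.<⇒≢ k<h))) ⟩
    ι (k ≡ᵇ h) * ι (go 0 false (s ∷ w)) + Σ≤ (length w) (λ i → ι (goPrime (suc h) false (D (suc k) ∷ s ∷ take i w)) * ι (go 0 false (drop i w)))
      ≡⟨ sym (firstReturnSum-D∷ k s w h) ⟩
    firstReturnSum (suc h) false (D (suc k) ∷ s ∷ w) ∎
    where
    open P.≡-Reasoning
    below-h : ∀ x → ((suc k ℕ.<ᵇ suc h) ∧ goPrime (h ∸ k) true x) ≡ goPrime (suc (h ∸ suc k)) true x
    below-h x = cong₂ (λ q h' → q ∧ goPrime h' true x) (≤⇒≤ᵇ≡true (s≤s k<h)) (suc-∸ k<h)
  ... | tri≈ _ refl _ = begin
    ι ((k ℕ.<ᵇ suc k) ∧ go (k ∸ k) true (s ∷ w))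
      ≡⟨ cong ι (cong₂ (λ q h' → q ∧ go h' true (s ∷ w)) (≤⇒≤ᵇ≡true {suc k} {suc k} ℕP.≤-refl) (ℕP.n∸n≡0 k)) ⟩
    ι (go 0 true (s ∷ w))
      ≡⟨ cong ι (go₀-flag-irrelevant (s ∷ w)) ⟩
    ι (go 0 false (s ∷ w))
      ≡⟨ sym (trans (ℤP.+-identityʳ _) (ℤP.*-identityˡ _)) ⟩
    ι true * ι (go 0 false (s ∷ w)) + + 0
      ≡⟨ cong₂ (λ q z → ι q * ι (go 0 false (s ∷ w)) + z) (sym (≡ᵇ-refl k))
           (sym (Σ≤-vanishing (length w) _ (λ i _ → cong (λ q → ι (q ∧ goPrime (k ∸ k) true (s ∷ take i w)) * ι (go 0 false (drop i w)))
             (>⇒≤ᵇ≡false {suc (suc k)} {suc k} ℕP.≤-refl)))) ⟩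
    ι (k ≡ᵇ k) * ι (go 0 false (s ∷ w)) + Σ≤ (length w) (λ i → ι (goPrime (suc k) false (D (suc k) ∷ s ∷ take i w)) * ι (go 0 false (drop i w)))
      ≡⟨ sym (firstReturnSum-D∷ k s w k) ⟩
    firstReturnSum (suc k) false (D (suc k) ∷ s ∷ w) ∎
    where open P.≡-Reasoning
  ... | tri> _ _ k>h = begin
    ι ((k ℕ.<ᵇ suc h) ∧ go (h ∸ k) true (s ∷ w))
      ≡⟨ cong (λ q → ι (q ∧ go (h ∸ k) true (s ∷ w))) (>⇒≤ᵇ≡false {suc k} {suc h} (s≤s k>h)) ⟩
    + 0 + + 0
      ≡⟨ cong₂ (λ q z → ι q * ι (go 0 false (s ∷ w)) + z) (sym (≢⇒≡ᵇ≡false (λ e → ℕP.<⇒≢ k>h (sym e))))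
           (sym (Σ≤-vanishing (length w) _ (λ i _ → cong (λ q → ι (q ∧ goPrime (h ∸ k) true (s ∷ take i w)) * ι (go 0 false (drop i w)))
             (>⇒≤ᵇ≡false {suc (suc k)} {suc h} (s≤s (ℕP.<⇒≤ (s≤s k>h))))))) ⟩
    ι (k ≡ᵇ h) * ι (go 0 false (s ∷ w)) + Σ≤ (length w) (λ i → ι (goPrime (suc h) false (D (suc k) ∷ s ∷ take i w)) * ι (go 0 false (drop i w)))
      ≡⟨ sym (firstReturnSum-D∷ k s w h) ⟩
    firstReturnSum (suc h) false (D (suc k) ∷ s ∷ w) ∎
    where open P.≡-Reasoning

  go₀-firstReturn : ∀ w → w ≢ [] → ι (go 0 false w) ≡ firstReturnSum 0 false w
  go₀-firstReturn [] ne = ⊥-elim (ne refl)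
  go₀-firstReturn (U ∷ w) ne = trans (go-firstReturn w 0 false) (sym (trans (Σ≤-shift (length w) _) (ℤP.+-identityˡ _)))
  go₀-firstReturn (D zero ∷ w) ne = sym (trans (Σ≤-shift (length w) _) (trans (ℤP.+-identityˡ _)
     (Σ≤-vanishing (length w) _ (λ i _ → cong (λ q → ι q * ι (go 0 false (drop i w))) (goPrime-D₀ 0 (take i w))))))
  go₀-firstReturn (D (suc k) ∷ w) ne = sym (trans (Σ≤-shift (length w) _) (trans (ℤP.+-identityˡ _)
     (Σ≤-vanishing (length w) _ (λ i _ → cong (λ q → ι q * ι (go 0 false (drop i w))) (goPrime₀-Dsuc k (take i w))))))
    where
    goPrime₀-Dsuc : ∀ k x → goPrime 0 false (D (suc k) ∷ x) ≡ false
    goPrime₀-Dsuc k [] = refl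
    goPrime₀-Dsuc k (s ∷ x) = refl


module Factorisation where

  open IntegerSums
  open WordSums
  open BoolLemmas
  open Pyramids
  open PathValidity
  open FirstReturn

  bool-ext : ∀ {a b : Bool} → (a ≡ true → b ≡ true) → (b ≡ true → a ≡ true) → a ≡ b
  bool-ext {true} f g = sym (f refl)
  bool-ext {false} {true} f g = g refl
  bool-ext {false} {false} f g = refl

  ι-+≡ᵇ-convolution : ∀ x y m → ι (x ℕ.+ y ≡ᵇ m) ≡ Σ≤ m (λ j → ι (x ≡ᵇ j) * ι (y ≡ᵇ m ∸ j))
  ι-+≡ᵇ-convolution x y m with x ℕ.≤? m
  ... | yes le = sym (trans (Σ≤-single m x _ (λ j ne → cong (λ q → ι q * ι (y ≡ᵇ m ∸ j)) (≢⇒≡ᵇ≡false (λ e → ne (sym e)))) le)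
                     (trans (cong (λ q → ι q * ι (y ≡ᵇ m ∸ x)) (≡ᵇ-refl x)) (trans (ℤP.*-identityˡ _) (cong ι (bool-ext y≡m∸x⇒x+y≡m x+y≡m⇒y≡m∸x)))))
    where
    y≡m∸x⇒x+y≡m : (y ≡ᵇ m ∸ x) ≡ true → (x ℕ.+ y ≡ᵇ m) ≡ true
    y≡m∸x⇒x+y≡m e = trans (cong (λ q → x ℕ.+ q ≡ᵇ m) (≡ᵇ≡true⇒≡ e)) (trans (cong (_≡ᵇ m) (ℕP.m+[n∸m]≡n le)) (≡ᵇ-refl m))
    x+y≡m⇒y≡m∸x : (x ℕ.+ y ≡ᵇ m) ≡ true → (y ≡ᵇ m ∸ x) ≡ true
    x+y≡m⇒y≡m∸x e = trans (cong (λ q → y ≡ᵇ q ∸ x) (sym (≡ᵇ≡true⇒≡ e))) (trans (cong (y ≡ᵇ_) (ℕP.m+n∸m≡n x y)) (≡ᵇ-refl y))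
  ... | no nle = trans (cong ι (≢⇒≡ᵇ≡false (λ e → nle (subst (x ≤_) e (ℕP.m≤m+n x y)))))
       (sym (Σ≤-vanishing m _ (λ j le → cong (λ q → ι q * ι (y ≡ᵇ m ∸ j)) (≢⇒≡ᵇ≡false (λ e → nle (subst (_≤ m) (sym e) le))))))

  module _ (k' : ℕ) where
    K : ℕ
    K = suc k'

    occ-++-prime : ∀ u v → goPrime 0 false u ≡ true → occ K (u ++ v) ≡ occ K u ℕ.+ occ K v
    occ-++-prime u v e with initLast u
    ... | [] = ⊥-elim (true≢false (sym e))
    ... | u₀ ∷ʳ′ U = ⊥-elim (true≢false (trans (sym e) (goPrime-snocU 0 false u₀)))
    ... | u₀ ∷ʳ′ D x = trans (cong (occ K) (LP.++-assoc u₀ (D x ∷ []) v)) (occ-++-afterD k' u₀ x v)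

    indicator-split : ∀ u v m → ι (goPrime 0 false u) * ι (go 0 false v) * ι (occ K (u ++ v) ≡ᵇ m)
           ≡ Σ≤ m (λ j → (ι (goPrime 0 false u) * ι (occ K u ≡ᵇ j)) * (ι (go 0 false v) * ι (occ K v ≡ᵇ m ∸ j)))
    indicator-split u v m with bool-cases (goPrime 0 false u)
    ... | inj₂ e rewrite e = sym (Σ≤-vanishing m _ (λ j _ → refl))
    ... | inj₁ e rewrite e = begin
      + 1 * ι (go 0 false v) * ι (occ K (u ++ v) ≡ᵇ m) ≡⟨ cong (λ q → + 1 * ι (go 0 false v) * ι (q ≡ᵇ m)) (occ-++-prime u v e) ⟩
      + 1 * ι (go 0 false v) * ι (occ K u ℕ.+ occ K v ≡ᵇ m) ≡⟨ cong (λ q → + 1 * ι (go 0 false v) * q) (ι-+≡ᵇ-convolution (occ K u) (occ K v) m) ⟩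
      + 1 * ι (go 0 false v) * Σ≤ m (λ j → ι (occ K u ≡ᵇ j) * ι (occ K v ≡ᵇ m ∸ j)) ≡⟨ Σ≤-*ˡ m (+ 1 * ι (go 0 false v)) (λ j → ι (occ K u ≡ᵇ j) * ι (occ K v ≡ᵇ m ∸ j)) ⟩
      Σ≤ m (λ j → + 1 * ι (go 0 false v) * (ι (occ K u ≡ᵇ j) * ι (occ K v ≡ᵇ m ∸ j)))
        ≡⟨ Σ≤-cong m (λ j → *-interchange (+ 1) (ι (go 0 false v)) (ι (occ K u ≡ᵇ j)) (ι (occ K v ≡ᵇ m ∸ j))) ⟩
      Σ≤ m (λ j → (+ 1 * ι (occ K u ≡ᵇ j)) * (ι (go 0 false v) * ι (occ K v ≡ᵇ m ∸ j))) ∎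
      where
      open P.≡-Reasoning
      open import Algebra.Properties.CommutativeSemigroup ℤP.*-commutativeSemigroup using () renaming (interchange to *-interchange)

    pathCount : List Step → ℕ → ℕ → ℤ
    pathCount a n m = sumWords a n (λ w → ι (go 0 false w) * ι (occ K w ≡ᵇ m))

    primeCount : List Step → ℕ → ℕ → ℤ
    primeCount a n m = sumWords a n (λ w → ι (goPrime 0 false w) * ι (occ K w ≡ᵇ m))

    splitTerm : ℕ → ℕ → List Step → List Step → ℤ
    splitTerm m j u v = (ι (goPrime 0 false u) * ι (occ K u ≡ᵇ j)) * (ι (go 0 false v) * ι (occ K v ≡ᵇ m ∸ j))

    indicator-firstReturn : ∀ n m w → length w ≡ suc n →
      ι (go 0 false w) * ι (occ K w ≡ᵇ m) ≡ Σ≤ (suc n) (λ i → Σ≤ m (λ j → splitTerm m j (take i w) (drop i w)))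
    indicator-firstReturn n m w e = begin
      ι (go 0 false w) * O
        ≡⟨ cong (_* O) (go₀-firstReturn w w≢[]) ⟩
      firstReturnSum 0 false w * O
        ≡⟨ cong (λ q → Σ≤ q returnAt * O) e ⟩
      Σ≤ (suc n) returnAt * O
        ≡⟨ trans (ℤP.*-comm (Σ≤ (suc n) returnAt) O) (Σ≤-*ˡ (suc n) O returnAt) ⟩
      Σ≤ (suc n) (λ i → O * returnAt i)
        ≡⟨ Σ≤-cong (suc n) (λ i → trans (ℤP.*-comm O (returnAt i))
             (cong (λ q → returnAt i * ι (occ K q ≡ᵇ m)) (sym (LP.take++drop≡id i w)))) ⟩
      Σ≤ (suc n) (λ i → returnAt i * ι (occ K (take i w ++ drop i w) ≡ᵇ m))
        ≡⟨ Σ≤-cong (suc n) (λ i → indicator-split (take i w) (drop i w) m) ⟩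
      Σ≤ (suc n) (λ i → Σ≤ m (λ j → splitTerm m j (take i w) (drop i w))) ∎
      where
      open P.≡-Reasoning
      O : ℤ
      O = ι (occ K w ≡ᵇ m)
      returnAt : ℕ → ℤ
      returnAt i = ι (goPrime 0 false (take i w)) * ι (go 0 false (drop i w))
      w≢[] : w ≢ []
      w≢[] w≡[] = ℕP.0≢1+n (trans (sym (cong length w≡[])) e)

    pathCount-firstReturn : ∀ a n m →
      pathCount a (suc n) m ≡ Σ≤ (suc n) (λ i → Σ≤ m (λ j → primeCount a i j * pathCount a (suc n ∸ i) (m ∸ j)))
    pathCount-firstReturn a n m = begin
      sumWords a (suc n) (λ w → ι (go 0 false w) * ι (occ K w ≡ᵇ m))
        ≡⟨ sumWords-cong a (suc n) (indicator-firstReturn n m) ⟩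
      sumWords a (suc n) (λ w → Σ≤ (suc n) (λ i → Σ≤ m (λ j → splitTerm m j (take i w) (drop i w))))
        ≡⟨ sumWords-Σ≤ a (suc n) (suc n) (λ i w → Σ≤ m (λ j → splitTerm m j (take i w) (drop i w))) ⟩
      Σ≤ (suc n) (λ i → sumWords a (suc n) (λ w → Σ≤ m (λ j → splitTerm m j (take i w) (drop i w))))
        ≡⟨ Σ≤-cong (suc n) (λ i → sumWords-Σ≤ a (suc n) m (λ j w → splitTerm m j (take i w) (drop i w))) ⟩
      Σ≤ (suc n) (λ i → Σ≤ m (λ j → sumWords a (suc n) (λ w → splitTerm m j (take i w) (drop i w))))
        ≡⟨ Σ≤-cong≤ (suc n) (λ i i≤ → Σ≤-cong m (λ j →
              trans (sumWords-splitAt a (suc n) i i≤ (splitTerm m j))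
                    (sumWords-product a i (suc n ∸ i) (λ u → ι (goPrime 0 false u) * ι (occ K u ≡ᵇ j))
                                                      (λ v → ι (go 0 false v) * ι (occ K v ≡ᵇ m ∸ j))))) ⟩
      Σ≤ (suc n) (λ i → Σ≤ m (λ j → primeCount a i j * pathCount a (suc n ∸ i) (m ∸ j))) ∎
      where open P.≡-Reasoning


module AlphabetIndependence where

  open IntegerSums
  open WordSums
  open BoolLemmas
  open Pyramids
  open PathValidity
  open Factorisation

  sumList-applyUpTo : ∀ {A : Set} (h : ℕ → A) n (g : A → ℤ) → sumList (applyUpTo h (suc n)) g ≡ Σ≤ n (λ i → g (h i))
  sumList-applyUpTo h zero g = ℤP.+-identityʳ _
  sumList-applyUpTo h (suc n) g = trans (cong (λ z → g (h 0) + z) (sumList-applyUpTo (h ∘ suc) n g)) (sym (Σ≤-shift n (λ i → g (h i))))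

  sumList-alphabet : ∀ N f → sumList (alphabet (suc N)) f ≡ f U + Σ≤ N (λ i → f (D (suc i)))
  sumList-alphabet N f = cong (λ z → f U + z) (trans (sumList-map (λ i → D (suc i)) (applyUpTo (λ x → x) (suc N)) f) (sumList-applyUpTo (λ i → i) N (λ i → f (D (suc i)))))

  sumWords-alphabet-step : ∀ N l (F : List Step → ℤ) → (∀ w → length w ≡ l → D (suc (suc N)) ∈ w → F w ≡ + 0) →
    sumWords (alphabet (suc (suc N))) l F ≡ sumWords (alphabet (suc N)) l F
  sumWords-alphabet-step N zero F h = refl
  sumWords-alphabet-step N (suc l) F h = begin
    sumList (alphabet (suc (suc N))) (λ s → sumWords (alphabet (suc (suc N))) l (λ w → F (s ∷ w)))
      ≡⟨ sumList-cong (alphabet (suc (suc N))) (λ s → sumWords-alphabet-step N l (λ w → F (s ∷ w)) (λ w e i → h (s ∷ w) (cong suc e) (there i))) ⟩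
    sumList (alphabet (suc (suc N))) G ≡⟨ sumList-alphabet (suc N) G ⟩
    G U + Σ≤ (suc N) (λ i → G (D (suc i))) ≡⟨⟩
    G U + (Σ≤ N (λ i → G (D (suc i))) + G (D (suc (suc N))))
      ≡⟨ cong (λ z → G U + (Σ≤ N (λ i → G (D (suc i))) + z)) (sumWords-vanishing (alphabet (suc N)) l _ (λ w e → h (D (suc (suc N)) ∷ w) (cong suc e) (here refl))) ⟩
    G U + (Σ≤ N (λ i → G (D (suc i))) + + 0) ≡⟨ cong (λ z → G U + z) (ℤP.+-identityʳ _) ⟩
    G U + Σ≤ N (λ i → G (D (suc i))) ≡⟨ sym (sumList-alphabet N G) ⟩
    sumList (alphabet (suc N)) G ∎
    where
    open P.≡-Reasoning
    G : Step → ℤ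
    G s = sumWords (alphabet (suc N)) l (λ w → F (s ∷ w))

  VanishesOffPaths : (List Step → ℤ) → Set
  VanishesOffPaths F = ∀ w → go 0 false w ≡ false → F w ≡ + 0

  sumWords-alphabet-iter : ∀ d N l F → VanishesOffPaths F → l ≤ suc N → sumWords (alphabet (d ℕ.+ suc N)) l F ≡ sumWords (alphabet (suc N)) l F
  sumWords-alphabet-iter zero N l F g le = refl
  sumWords-alphabet-iter (suc d) N l F g le = trans (subst (λ q → sumWords (alphabet (suc q)) l F ≡ sumWords (alphabet q) l F) (sym (ℕP.+-suc d N))
       (sumWords-alphabet-step (d ℕ.+ N) l F vanishes-on-D)) (sumWords-alphabet-iter d N l F g le)
    where
    vanishes-on-D : ∀ w → length w ≡ l → D (suc (suc (d ℕ.+ N))) ∈ w → F w ≡ + 0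
    vanishes-on-D w e i with bool-cases (go 0 false w)
    ... | inj₂ e2 = g w e2
    ... | inj₁ e2 = ⊥-elim (ℕP.<⇒≱ (s≤s (ℕP.≤-trans (subst (_≤ suc N) (sym e) le) (s≤s (ℕP.m≤n+m N d)))) (downStep-bound 0 false w _ e2 i))

  sumWords-alphabet : ∀ M N l F → VanishesOffPaths F → l ≤ suc N → suc N ≤ M → sumWords (alphabet M) l F ≡ sumWords (alphabet (suc N)) l F
  sumWords-alphabet M N l F g le le2 = subst (λ q → sumWords (alphabet q) l F ≡ sumWords (alphabet (suc N)) l F) (ℕP.m∸n+n≡m le2) (sumWords-alphabet-iter (M ∸ suc N) N l F g le)

  sumWords-canonical : ∀ M n F → VanishesOffPaths F → n ≤ M → sumWords (alphabet M) n F ≡ sumWords (alphabet n) n F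
  sumWords-canonical M zero F g le = refl
  sumWords-canonical M (suc n) F g le = sumWords-alphabet M n (suc n) F g ℕP.≤-refl le

  sumWords-isUᵏ : ∀ N n (G : List Step → ℤ) → sumWords (alphabet (suc N)) n (λ γ → ι (isUᵏ n γ) * G γ) ≡ G (replicate n U)
  sumWords-isUᵏ N zero G = ℤP.*-identityˡ _
  sumWords-isUᵏ N (suc n) G = begin
    sumList (alphabet (suc N)) (λ s → sumWords (alphabet (suc N)) n (λ γ → ι (isUᵏ (suc n) (s ∷ γ)) * G (s ∷ γ)))
      ≡⟨ sumList-alphabet N (λ s → sumWords (alphabet (suc N)) n (λ γ → ι (isUᵏ (suc n) (s ∷ γ)) * G (s ∷ γ))) ⟩
    sumWords (alphabet (suc N)) n (λ γ → ι (isUᵏ n γ) * G (U ∷ γ)) + Σ≤ N (λ i → sumWords (alphabet (suc N)) n (λ γ → + 0))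
      ≡⟨ cong₂ _+_ (sumWords-isUᵏ N n (λ γ → G (U ∷ γ))) (Σ≤-vanishing N _ (λ i _ → sumWords-0 (alphabet (suc N)) n)) ⟩
    G (replicate (suc n) U) + + 0 ≡⟨ ℤP.+-identityʳ _ ⟩
    G (replicate (suc n) U) ∎
    where open P.≡-Reasoning


module PrimePaths where

  open IntegerSums
  open WordSums
  open BoolLemmas
  open Pyramids
  open PathValidity
  open Factorisation hiding (K)
  open AlphabetIndependence

  indicator-shift : ∀ o e a m → (e ∧ a) ≡ false →
    ι (ιℕ a ℕ.+ o ≡ᵇ m) + ι e * ι (o ℕ.+ ιℕ e ≡ᵇ m) + ι a * ι (o ℕ.+ ιℕ e ≡ᵇ m)
    ≡ ι (o ℕ.+ ιℕ e ≡ᵇ m) + ι e * ι (o ℕ.+ ιℕ e ≡ᵇ suc m) + ι a * ι (suc (o ℕ.+ ιℕ e) ≡ᵇ m)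
  indicator-shift o false false m _ rewrite ℕP.+-identityʳ o = refl
  indicator-shift o true false m _ rewrite ℕP.+-comm o 1 = swap (ι (o ≡ᵇ m)) (ι (suc o ≡ᵇ m))
    where
    swap : ∀ x y → x + + 1 * y + + 0 ≡ y + + 1 * x + + 0
    swap = solve-∀
  indicator-shift o false true m _ rewrite ℕP.+-identityʳ o = swap (ι (o ≡ᵇ m)) (ι (suc o ≡ᵇ m))
    where
    swap : ∀ x y → y + + 0 + + 1 * x ≡ x + + 0 + + 1 * y
    swap = solve-∀
  indicator-shift o true true m ()

  module _ (k' : ℕ) where
    K : ℕ
    K = suc k'

    -- w D_j is a path iff its raise U w D_{j+1} is a prime path (goPrime-raiseLastDown).
    endsPath : List Step → ℕ → ℤ
    endsPath w j = ι (go 0 false (w ++ D j ∷ []))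
    occEnd : List Step → ℕ → ℕ
    occEnd w j = occ K (w ++ D j ∷ [])
    occRaised : List Step → ℕ → ℕ
    occRaised w j = occ K (U ∷ w ++ D (suc j) ∷ [])
    pyramidAtEnd : List Step → ℕ → Bool
    pyramidAtEnd w j = endsWithUᵏ K w ∧ (K ≡ᵇ j)
    raisedIsPyramid : List Step → ℕ → Bool
    raisedIsPyramid w j = isUᵏ k' w ∧ (K ≡ᵇ suc j)

    occEnd-split : ∀ w j → occEnd w j ≡ occ K w ℕ.+ ιℕ (pyramidAtEnd w j)
    occEnd-split w j = occ-snocD k' w j

    occRaised-split : ∀ w j → go 0 false (w ++ D j ∷ []) ≡ true → occRaised w j ≡ ιℕ (raisedIsPyramid w j) ℕ.+ occ K w
    occRaised-split w j v = begin
      ιℕ (isPrefix (pyramid K) (U ∷ w ++ D (suc j) ∷ [])) ℕ.+ occ K (w ++ D (suc j) ∷ [])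
        ≡⟨ cong₂ ℕ._+_ (isPrefix-pyramid-snocD K K (U ∷ w) (suc j)) (occ-snocD k' w (suc j)) ⟩
      (ιℕ (isPrefix (pyramid K) (U ∷ w)) ℕ.+ ιℕ (isUᵏ K (U ∷ w) ∧ (K ≡ᵇ suc j))) ℕ.+ (occ K w ℕ.+ ιℕ (endsWithUᵏ K w ∧ (K ≡ᵇ suc j)))
        ≡⟨ cong₂ (λ z1 z2 → (ιℕ z1 ℕ.+ ιℕ (raisedIsPyramid w j)) ℕ.+ (occ K w ℕ.+ ιℕ z2)) (¬isPrefix-pyramid-raised k' w j v) no-pyramid-at-end ⟩
      (0 ℕ.+ ιℕ (raisedIsPyramid w j)) ℕ.+ (occ K w ℕ.+ 0) ≡⟨ cong (ιℕ (raisedIsPyramid w j) ℕ.+_) (ℕP.+-identityʳ _) ⟩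
      ιℕ (raisedIsPyramid w j) ℕ.+ occ K w ∎
      where
      open P.≡-Reasoning
      no-pyramid-at-end : (endsWithUᵏ K w ∧ (K ≡ᵇ suc j)) ≡ false
      no-pyramid-at-end with bool-cases (endsWithUᵏ K w)
      ... | inj₂ e = cong (_∧ (K ≡ᵇ suc j)) e
      ... | inj₁ e = trans (cong (_∧ (K ≡ᵇ suc j)) e) (≢⇒≡ᵇ≡false (λ eq → ℕP.<⇒≢ (s≤s (endsWithUᵏ⇒k≤lastDown k' w j v e)) eq))

    pyramidAtEnd-exclusive : ∀ w j → (pyramidAtEnd w j ∧ raisedIsPyramid w j) ≡ false
    pyramidAtEnd-exclusive w j with bool-cases (K ≡ᵇ j)
    ... | inj₂ e = trans (cong (λ q → (endsWithUᵏ K w ∧ q) ∧ raisedIsPyramid w j) e) (cong (_∧ raisedIsPyramid w j) (∧-zeroʳ (endsWithUᵏ K w)))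
    ... | inj₁ e with ≡ᵇ≡true⇒≡ {K} {j} e
    ...   | refl = trans (cong (λ q → pyramidAtEnd w K ∧ (isUᵏ k' w ∧ q)) (≢⇒≡ᵇ≡false {K} {suc K} (λ eq → ℕP.<⇒≢ (ℕP.n<1+n K) eq))) (trans (cong (pyramidAtEnd w K ∧_) (∧-zeroʳ (isUᵏ k' w))) (∧-zeroʳ _))

    indicator-identity : ∀ w j m →
      endsPath w j * ι (occRaised w j ≡ᵇ m)
        + endsPath w j * ι (pyramidAtEnd w j) * ι (occEnd w j ≡ᵇ m)
        + endsPath w j * ι (raisedIsPyramid w j) * ι (occEnd w j ≡ᵇ m)
      ≡ endsPath w j * ι (occEnd w j ≡ᵇ m)
        + endsPath w j * ι (pyramidAtEnd w j) * ι (occEnd w j ≡ᵇ suc m)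
        + endsPath w j * ι (raisedIsPyramid w j) * ι (suc (occEnd w j) ≡ᵇ m)
    indicator-identity w j m with bool-cases (go 0 false (w ++ D j ∷ []))
    ... | inj₂ invalid rewrite invalid = refl
    ... | inj₁ valid rewrite valid | occRaised-split w j valid | occEnd-split w j = begin
      + 1 * ι (ιℕ r ℕ.+ o ≡ᵇ m) + + 1 * ι e * ι (o ℕ.+ ιℕ e ≡ᵇ m) + + 1 * ι r * ι (o ℕ.+ ιℕ e ≡ᵇ m)
        ≡⟨ drop-units (ι (ιℕ r ℕ.+ o ≡ᵇ m)) (ι e) (ι (o ℕ.+ ιℕ e ≡ᵇ m)) (ι r) (ι (o ℕ.+ ιℕ e ≡ᵇ m)) ⟩
      ι (ιℕ r ℕ.+ o ≡ᵇ m) + ι e * ι (o ℕ.+ ιℕ e ≡ᵇ m) + ι r * ι (o ℕ.+ ιℕ e ≡ᵇ m)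
        ≡⟨ indicator-shift o e r m (pyramidAtEnd-exclusive w j) ⟩
      ι (o ℕ.+ ιℕ e ≡ᵇ m) + ι e * ι (o ℕ.+ ιℕ e ≡ᵇ suc m) + ι r * ι (suc (o ℕ.+ ιℕ e) ≡ᵇ m)
        ≡⟨ sym (drop-units (ι (o ℕ.+ ιℕ e ≡ᵇ m)) (ι e) (ι (o ℕ.+ ιℕ e ≡ᵇ suc m)) (ι r) (ι (suc (o ℕ.+ ιℕ e) ≡ᵇ m))) ⟩
      + 1 * ι (o ℕ.+ ιℕ e ≡ᵇ m) + + 1 * ι e * ι (o ℕ.+ ιℕ e ≡ᵇ suc m) + + 1 * ι r * ι (suc (o ℕ.+ ιℕ e) ≡ᵇ m) ∎
      where
      open P.≡-Reasoning
      e : Bool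
      e = pyramidAtEnd w j
      r : Bool
      r = raisedIsPyramid w j
      o : ℕ
      o = occ K w
      drop-units : ∀ a b c d f → + 1 * a + + 1 * b * c + + 1 * d * f ≡ a + b * c + d * f
      drop-units = solve-∀

    pathIndicator-vanishes : ∀ m → VanishesOffPaths (λ w → ι (go 0 false w) * ι (occ K w ≡ᵇ m))
    pathIndicator-vanishes m w e rewrite e = refl

    primeIndicator-vanishes : ∀ m → VanishesOffPaths (λ w → ι (goPrime 0 false w) * ι (occ K w ≡ᵇ m))
    primeIndicator-vanishes m w e with bool-cases (goPrime 0 false w)
    ... | inj₂ e2 rewrite e2 = refl
    ... | inj₁ e2 = ⊥-elim (true≢false (trans (sym (goPrime⇒go 0 false w e2)) e))

    UD₁-term : ℕ → ℕ → ℤ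
    UD₁-term l m = ι (l ≡ᵇ 0) * ι (occ K (U ∷ D 1 ∷ []) ≡ᵇ m)

    -- Words of length up to N + 2 are summed over one common alphabet; by sumWords-canonical its size is irrelevant.
    module Bounded (N : ℕ) where
      a : List Step
      a = alphabet (suc (suc N))

      raisedSummand : ℕ → List Step → ℕ → ℤ
      raisedSummand m w i = endsPath w (suc i) * ι (occRaised w (suc i) ≡ᵇ m)

      lastStepD₁ : ℕ → List Step → ℤ
      lastStepD₁ m w = ι (goPrime 1 false (w ++ D 1 ∷ [])) * ι (occ K (U ∷ w ++ D 1 ∷ []) ≡ᵇ m)

      prime-by-last-step : ∀ m w →
        sumList a (λ s → ι (goPrime 1 false (w ++ s ∷ [])) * ι (occ K (U ∷ w ++ s ∷ []) ≡ᵇ m))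
          ≡ lastStepD₁ m w + Σ≤ N (raisedSummand m w)
      prime-by-last-step m w = begin
        sumList a (λ s → ι (goPrime 1 false (w ++ s ∷ [])) * ι (occ K (U ∷ w ++ s ∷ []) ≡ᵇ m))
          ≡⟨ sumList-alphabet (suc N) (λ s → ι (goPrime 1 false (w ++ s ∷ [])) * ι (occ K (U ∷ w ++ s ∷ []) ≡ᵇ m)) ⟩
        ι (goPrime 1 false (w ++ U ∷ [])) * ι (occ K (U ∷ w ++ U ∷ []) ≡ᵇ m)
          + Σ≤ (suc N) (λ i → ι (goPrime 1 false (w ++ D (suc i) ∷ [])) * ι (occ K (U ∷ w ++ D (suc i) ∷ []) ≡ᵇ m))
          ≡⟨ cong₂ _+_ (cong (λ q → ι q * ι (occ K (U ∷ w ++ U ∷ []) ≡ᵇ m)) (goPrime-snocU 1 false w)) (Σ≤-shift N _) ⟩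
        + 0 + (lastStepD₁ m w + Σ≤ N (λ i → ι (goPrime 1 false (w ++ D (suc (suc i)) ∷ [])) * ι (occ K (U ∷ w ++ D (suc (suc i)) ∷ []) ≡ᵇ m)))
          ≡⟨ ℤP.+-identityˡ _ ⟩
        lastStepD₁ m w + Σ≤ N (λ i → ι (goPrime 1 false (w ++ D (suc (suc i)) ∷ [])) * ι (occ K (U ∷ w ++ D (suc (suc i)) ∷ []) ≡ᵇ m))
          ≡⟨ cong (λ q → lastStepD₁ m w + q) (Σ≤-cong N (λ i →
               cong (λ q → ι q * ι (occ K (U ∷ w ++ D (suc (suc i)) ∷ []) ≡ᵇ m)) (goPrime-raiseLastDown 0 false w i))) ⟩
        lastStepD₁ m w + Σ≤ N (raisedSummand m w) ∎
        where open P.≡-Reasoning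

      sum-lastStepD₁ : ∀ l m → sumWords a l (lastStepD₁ m) ≡ UD₁-term l m
      sum-lastStepD₁ zero m = refl
      sum-lastStepD₁ (suc l) m = sumWords-vanishing a (suc l) (lastStepD₁ m) lastStepD₁-vanishes
        where
        lastStepD₁-vanishes : ∀ w → length w ≡ suc l → lastStepD₁ m w ≡ + 0
        lastStepD₁-vanishes w e with bool-cases (goPrime 1 false (w ++ D 1 ∷ []))
        ... | inj₂ e2 rewrite e2 = refl
        ... | inj₁ e2 = ⊥-elim (ℕP.0≢1+n (trans (sym (cong length (goPrime-snocD₁⇒[] 0 false w e2))) e))

      primeCount-by-last : ∀ l m →
        primeCount k' a (suc (suc l)) m ≡ UD₁-term l m + sumWords a l (λ w → Σ≤ N (raisedSummand m w))
      primeCount-by-last l m = begin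
        sumList a (λ s → sumWords a (suc l) (λ u → ι (goPrime 0 false (s ∷ u)) * ι (occ K (s ∷ u) ≡ᵇ m)))
          ≡⟨ sumList-alphabet (suc N) (λ s → sumWords a (suc l) (λ u → ι (goPrime 0 false (s ∷ u)) * ι (occ K (s ∷ u) ≡ᵇ m))) ⟩
        startingWithU + Σ≤ (suc N) startingWithD
          ≡⟨ cong (λ q → startingWithU + q) (Σ≤-vanishing (suc N) startingWithD (λ i _ → sumWords-vanishing a (suc l) (λ u → ι (goPrime 0 false (D (suc i) ∷ u)) * ι (occ K (D (suc i) ∷ u) ≡ᵇ m)) (λ { (s ∷ u) _ → refl }))) ⟩
        startingWithU + + 0
          ≡⟨ ℤP.+-identityʳ _ ⟩
        startingWithU
          ≡⟨ sumWords-snoc a l (λ u → ι (goPrime 1 false u) * ι (occ K (U ∷ u) ≡ᵇ m)) ⟩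
        sumWords a l (λ w → sumList a (λ s → ι (goPrime 1 false (w ++ s ∷ [])) * ι (occ K (U ∷ w ++ s ∷ []) ≡ᵇ m)))
          ≡⟨ sumWords-cong a l (λ w _ → prime-by-last-step m w) ⟩
        sumWords a l (λ w → lastStepD₁ m w + Σ≤ N (raisedSummand m w))
          ≡⟨ sumWords-+ a l (lastStepD₁ m) _ ⟩
        sumWords a l (lastStepD₁ m) + sumWords a l (λ w → Σ≤ N (raisedSummand m w))
          ≡⟨ cong (_+ sumWords a l (λ w → Σ≤ N (raisedSummand m w))) (sum-lastStepD₁ l m) ⟩
        UD₁-term l m + sumWords a l (λ w → Σ≤ N (raisedSummand m w)) ∎
        where
        open P.≡-Reasoning
        startingWithU : ℤ
        startingWithU = sumWords a (suc l) (λ u → ι (goPrime 1 false u) * ι (occ K (U ∷ u) ≡ᵇ m))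
        startingWithD : ℕ → ℤ
        startingWithD i = sumWords a (suc l) (λ u → ι (goPrime 0 false (D (suc i) ∷ u)) * ι (occ K (D (suc i) ∷ u) ≡ᵇ m))

      pathCount-by-last : ∀ l m → l ≤ N → pathCount k' a (suc l) m ≡ sumWords a l (λ w → Σ≤ N (λ i → endsPath w (suc i) * ι (occEnd w (suc i) ≡ᵇ m)))
      pathCount-by-last l m le = begin
        sumWords a (suc l) (λ w → ι (go 0 false w) * ι (occ K w ≡ᵇ m)) ≡⟨ sumWords-snoc a l (λ w → ι (go 0 false w) * ι (occ K w ≡ᵇ m)) ⟩
        sumWords a l (λ w → sumList a (λ s → ι (go 0 false (w ++ s ∷ [])) * ι (occ K (w ++ s ∷ []) ≡ᵇ m)))
          ≡⟨ sumWords-cong a l split-last-step ⟩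
        sumWords a l (λ w → Σ≤ N (λ i → endsPath w (suc i) * ι (occEnd w (suc i) ≡ᵇ m))) ∎
        where
        open P.≡-Reasoning
        split-last-step : ∀ w → length w ≡ l → sumList a (λ s → ι (go 0 false (w ++ s ∷ [])) * ι (occ K (w ++ s ∷ []) ≡ᵇ m))
                 ≡ Σ≤ N (λ i → endsPath w (suc i) * ι (occEnd w (suc i) ≡ᵇ m))
        split-last-step w e = begin
          sumList a (λ s → ι (go 0 false (w ++ s ∷ [])) * ι (occ K (w ++ s ∷ []) ≡ᵇ m))
            ≡⟨ sumList-alphabet (suc N) (λ s → ι (go 0 false (w ++ s ∷ [])) * ι (occ K (w ++ s ∷ []) ≡ᵇ m)) ⟩
          ι (go 0 false (w ++ U ∷ [])) * ι (occ K (w ++ U ∷ []) ≡ᵇ m) + (Σ≤ N (λ i → endsPath w (suc i) * ι (occEnd w (suc i) ≡ᵇ m)) + endsPath w (suc (suc N)) * ι (occEnd w (suc (suc N)) ≡ᵇ m))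
            ≡⟨ cong₂ (λ q r → ι q * ι (occ K (w ++ U ∷ []) ≡ᵇ m) + (Σ≤ N (λ i → endsPath w (suc i) * ι (occEnd w (suc i) ≡ᵇ m)) + r * ι (occEnd w (suc (suc N)) ≡ᵇ m)))
                 (go-snocU 0 false w) last-step-too-deep ⟩
          + 0 + (Σ≤ N (λ i → endsPath w (suc i) * ι (occEnd w (suc i) ≡ᵇ m)) + + 0) ≡⟨ trans (ℤP.+-identityˡ _) (ℤP.+-identityʳ _) ⟩
          Σ≤ N (λ i → endsPath w (suc i) * ι (occEnd w (suc i) ≡ᵇ m)) ∎
          where
          last-step-too-deep : endsPath w (suc (suc N)) ≡ + 0
          last-step-too-deep with bool-cases (go 0 false (w ++ D (suc (suc N)) ∷ []))
          ... | inj₂ e2 = cong ι e2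
          ... | inj₁ e2 = ⊥-elim (ℕP.<⇒≱ (s≤s (s≤s le)) (ℕP.≤-trans (downStep-bound 0 false (w ++ D (suc (suc N)) ∷ []) (suc (suc N)) e2 (∈-++⁺ʳ w (here refl)))
                            (ℕP.≤-reflexive (trans (LP.length-++ w) (trans (cong (ℕ._+ 1) e) (ℕP.+-comm l 1))))))

      pyramidAtEnd-sum : ∀ l M → k' ≤ N →
        sumWords a l (λ w → Σ≤ N (λ i → endsPath w (suc i) * ι (pyramidAtEnd w (suc i)) * ι (occEnd w (suc i) ≡ᵇ M)))
        ≡ ι (K ≤ᵇ l) * sumWords a (l ∸ K) (λ β → ι (go 0 false β) * ι (suc (occ K β) ≡ᵇ M))
      pyramidAtEnd-sum l M kle = trans (sumWords-cong a l (λ w _ → only-j≡K w)) (sum-endsInPyramid l)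
        where
        open P.≡-Reasoning
        endsInPyramid : List Step → ℤ
        endsInPyramid w = endsPath w K * ι (endsWithUᵏ K w) * ι (occEnd w K ≡ᵇ M)
        only-j≡K : ∀ w → Σ≤ N (λ i → endsPath w (suc i) * ι (pyramidAtEnd w (suc i)) * ι (occEnd w (suc i) ≡ᵇ M)) ≡ endsInPyramid w
        only-j≡K w = trans (Σ≤-single N k' _ j≢K kle)
          (cong (λ q → endsPath w K * ι q * ι (occEnd w K ≡ᵇ M)) (trans (cong (endsWithUᵏ K w ∧_) (≡ᵇ-refl k')) (∧-identityʳ (endsWithUᵏ K w))))
          where
          j≢K : ∀ i → i ≢ k' → endsPath w (suc i) * ι (pyramidAtEnd w (suc i)) * ι (occEnd w (suc i) ≡ᵇ M) ≡ + 0
          j≢K i ne = trans (cong (λ q → endsPath w (suc i) * ι q * ι (occEnd w (suc i) ≡ᵇ M)) (trans (cong (endsWithUᵏ K w ∧_) (≢⇒≡ᵇ≡false (λ e → ne (sym e)))) (∧-zeroʳ _)))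
                     (trans (cong (_* ι (occEnd w (suc i) ≡ᵇ M)) (ℤP.*-zeroʳ (endsPath w (suc i)))) refl)
        sum-endsInPyramid : ∀ l → sumWords a l endsInPyramid ≡ ι (K ≤ᵇ l) * sumWords a (l ∸ K) (λ β → ι (go 0 false β) * ι (suc (occ K β) ≡ᵇ M))
        sum-endsInPyramid l with K ℕ.≤? l
        ... | no nle = trans (sumWords-vanishing a l endsInPyramid (λ w e → trans (cong (λ q → endsPath w K * ι q * ι (occEnd w K ≡ᵇ M)) (endsWithUᵏ-short K w (subst (_< K) (sym e) (ℕP.≰⇒> nle))))
                          (trans (cong (_* ι (occEnd w K ≡ᵇ M)) (ℤP.*-zeroʳ (endsPath w K))) refl)))
                       (sym (cong (λ q → ι q * sumWords a (l ∸ K) (λ β → ι (go 0 false β) * ι (suc (occ K β) ≡ᵇ M))) (>⇒≤ᵇ≡false (ℕP.≰⇒> nle))))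
        ... | yes le = begin
          sumWords a l endsInPyramid ≡⟨ cong (λ q → sumWords a q endsInPyramid) (sym (trans (ℕP.+-comm (l ∸ K) K) (ℕP.m+[n∸m]≡n le))) ⟩
          sumWords a ((l ∸ K) ℕ.+ K) endsInPyramid ≡⟨ sumWords-++ a (l ∸ K) K endsInPyramid ⟩
          sumWords a (l ∸ K) (λ β → sumWords a K (λ γ → endsInPyramid (β ++ γ)))
            ≡⟨ sumWords-cong a (l ∸ K) (λ β _ → trans (sumWords-cong a K (λ γ eγ → split-Uᵏ-suffix β γ eγ)) (sumWords-isUᵏ (suc N) K (λ γ → endsPath (β ++ γ) K * ι (occEnd (β ++ γ) K ≡ᵇ M)))) ⟩
          sumWords a (l ∸ K) (λ β → endsPath (β ++ replicate K U) K * ι (occEnd (β ++ replicate K U) K ≡ᵇ M))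
            ≡⟨ sumWords-cong a (l ∸ K) (λ β _ → cong₂ (λ q r → ι q * ι (r ≡ᵇ M))
                 (trans (cong (go 0 false) (LP.++-assoc β (replicate K U) (D K ∷ []))) (go-++-pyramid 0 false β k'))
                 (trans (cong (occ K) (LP.++-assoc β (replicate K U) (D K ∷ []))) (occ-++-pyramid k' β))) ⟩
          sumWords a (l ∸ K) (λ β → ι (go 0 false β) * ι (suc (occ K β) ≡ᵇ M)) ≡⟨ sym (ℤP.*-identityˡ _) ⟩
          + 1 * sumWords a (l ∸ K) (λ β → ι (go 0 false β) * ι (suc (occ K β) ≡ᵇ M))
            ≡⟨ cong (λ q → ι q * sumWords a (l ∸ K) (λ β → ι (go 0 false β) * ι (suc (occ K β) ≡ᵇ M))) (sym (≤⇒≤ᵇ≡true le)) ⟩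
          ι (K ≤ᵇ l) * sumWords a (l ∸ K) (λ β → ι (go 0 false β) * ι (suc (occ K β) ≡ᵇ M)) ∎
          where
          split-Uᵏ-suffix : ∀ β γ → length γ ≡ K → endsInPyramid (β ++ γ) ≡ ι (isUᵏ K γ) * (endsPath (β ++ γ) K * ι (occEnd (β ++ γ) K ≡ᵇ M))
          split-Uᵏ-suffix β γ eγ = trans (cong (λ q → endsPath (β ++ γ) K * ι q * ι (occEnd (β ++ γ) K ≡ᵇ M)) (endsWithUᵏ-++ K β γ eγ)) (rearrange (endsPath (β ++ γ) K) (ι (isUᵏ K γ)) (ι (occEnd (β ++ γ) K ≡ᵇ M)))
            where
            rearrange : ∀ x y j≢K → x * y * j≢K ≡ y * (x * j≢K)
            rearrange = solve-∀

      sumWords-Σ≤-+₃ : ∀ l (f1 f2 f3 : List Step → ℕ → ℤ) →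
        sumWords a l (λ w → Σ≤ N (λ i → f1 w i + f2 w i + f3 w i))
        ≡ sumWords a l (λ w → Σ≤ N (f1 w)) + sumWords a l (λ w → Σ≤ N (f2 w)) + sumWords a l (λ w → Σ≤ N (f3 w))
      sumWords-Σ≤-+₃ l f1 f2 f3 = begin
        sumWords a l (λ w → Σ≤ N (λ i → f1 w i + f2 w i + f3 w i))
          ≡⟨ sumWords-cong a l (λ w _ → trans (Σ≤-+ N (λ i → f1 w i + f2 w i) (f3 w)) (cong (_+ Σ≤ N (f3 w)) (Σ≤-+ N (f1 w) (f2 w)))) ⟩
        sumWords a l (λ w → Σ≤ N (f1 w) + Σ≤ N (f2 w) + Σ≤ N (f3 w))
          ≡⟨ sumWords-+ a l (λ w → Σ≤ N (f1 w) + Σ≤ N (f2 w)) (λ w → Σ≤ N (f3 w)) ⟩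
        sumWords a l (λ w → Σ≤ N (f1 w) + Σ≤ N (f2 w)) + sumWords a l (λ w → Σ≤ N (f3 w))
          ≡⟨ cong (_+ sumWords a l (λ w → Σ≤ N (f3 w))) (sumWords-+ a l (λ w → Σ≤ N (f1 w)) (λ w → Σ≤ N (f2 w))) ⟩
        sumWords a l (λ w → Σ≤ N (f1 w)) + sumWords a l (λ w → Σ≤ N (f2 w)) + sumWords a l (λ w → Σ≤ N (f3 w)) ∎
        where open P.≡-Reasoning

      raisedPyramid-sum : ℕ → (ℕ → ℤ) → ℤ
      raisedPyramid-sum l g = sumWords a l (λ w → Σ≤ N (λ i → endsPath w (suc i) * ι (raisedIsPyramid w (suc i)) * g (occEnd w (suc i))))

      primeCount-recurrence : ∀ l m → l ≤ N → k' ≤ N →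
        primeCount k' a (suc (suc l)) m + ι (K ≤ᵇ l) * sumWords a (l ∸ K) (λ β → ι (go 0 false β) * ι (suc (occ K β) ≡ᵇ m)) + raisedPyramid-sum l (λ y → ι (y ≡ᵇ m))
        ≡ UD₁-term l m + pathCount k' a (suc l) m + ι (K ≤ᵇ l) * pathCount k' a (l ∸ K) m + raisedPyramid-sum l (λ y → ι (suc y ≡ᵇ m))
      primeCount-recurrence l m le kle = begin
        primeCount k' a (suc (suc l)) m + endingPyramids + raisedPyramid-sum l (λ y → ι (y ≡ᵇ m))
          ≡⟨ cong (λ q → q + endingPyramids + raisedPyramid-sum l (λ y → ι (y ≡ᵇ m))) (primeCount-by-last l m) ⟩
        UD₁-term l m + Σw (raisedSummand m) + endingPyramids + Σw (raisedPyramidSummand (λ y → ι (y ≡ᵇ m)))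
          ≡⟨ cong (λ q → UD₁-term l m + Σw (raisedSummand m) + q + Σw (raisedPyramidSummand (λ y → ι (y ≡ᵇ m))))
               (sym (pyramidAtEnd-sum l m kle)) ⟩
        UD₁-term l m + Σw (raisedSummand m) + Σw (atEndSummand m) + Σw (raisedPyramidSummand (λ y → ι (y ≡ᵇ m)))
          ≡⟨ regroup (UD₁-term l m) _ _ _ ⟩
        UD₁-term l m + (Σw (raisedSummand m) + Σw (atEndSummand m) + Σw (raisedPyramidSummand (λ y → ι (y ≡ᵇ m))))
          ≡⟨ cong (λ q → UD₁-term l m + q) (sym (sumWords-Σ≤-+₃ l (raisedSummand m) (atEndSummand m) (raisedPyramidSummand (λ y → ι (y ≡ᵇ m))))) ⟩
        UD₁-term l m + Σw (λ w i → raisedSummand m w i + atEndSummand m w i + raisedPyramidSummand (λ y → ι (y ≡ᵇ m)) w i)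
          ≡⟨ cong (λ q → UD₁-term l m + q) (sumWords-cong a l (λ w _ → Σ≤-cong N (λ i → indicator-identity w (suc i) m))) ⟩
        UD₁-term l m + Σw (λ w i → endSummand m w i + atEndSummand (suc m) w i + raisedPyramidSummand (λ y → ι (suc y ≡ᵇ m)) w i)
          ≡⟨ cong (λ q → UD₁-term l m + q) (sumWords-Σ≤-+₃ l (endSummand m) (atEndSummand (suc m)) (raisedPyramidSummand (λ y → ι (suc y ≡ᵇ m)))) ⟩
        UD₁-term l m + (Σw (endSummand m) + Σw (atEndSummand (suc m)) + raisedPyramid-sum l (λ y → ι (suc y ≡ᵇ m)))
          ≡⟨ cong₂ (λ q r → UD₁-term l m + (q + r + raisedPyramid-sum l (λ y → ι (suc y ≡ᵇ m))))
               (sym (pathCount-by-last l m le)) (pyramidAtEnd-sum l (suc m) kle) ⟩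
        UD₁-term l m + (pathCount k' a (suc l) m + ι (K ≤ᵇ l) * pathCount k' a (l ∸ K) m + raisedPyramid-sum l (λ y → ι (suc y ≡ᵇ m)))
          ≡⟨ sym (regroup (UD₁-term l m) _ _ _) ⟩
        UD₁-term l m + pathCount k' a (suc l) m + ι (K ≤ᵇ l) * pathCount k' a (l ∸ K) m + raisedPyramid-sum l (λ y → ι (suc y ≡ᵇ m)) ∎
        where
        open P.≡-Reasoning
        Σw : (List Step → ℕ → ℤ) → ℤ
        Σw f = sumWords a l (λ w → Σ≤ N (f w))
        endingPyramids : ℤ
        endingPyramids = ι (K ≤ᵇ l) * sumWords a (l ∸ K) (λ β → ι (go 0 false β) * ι (suc (occ K β) ≡ᵇ m))
        endSummand : ℕ → List Step → ℕ → ℤ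
        endSummand M w i = endsPath w (suc i) * ι (occEnd w (suc i) ≡ᵇ M)
        atEndSummand : ℕ → List Step → ℕ → ℤ
        atEndSummand M w i = endsPath w (suc i) * ι (pyramidAtEnd w (suc i)) * ι (occEnd w (suc i) ≡ᵇ M)
        raisedPyramidSummand : (ℕ → ℤ) → List Step → ℕ → ℤ
        raisedPyramidSummand g w i = endsPath w (suc i) * ι (raisedIsPyramid w (suc i)) * g (occEnd w (suc i))
        regroup : ∀ x y z t → x + y + z + t ≡ x + (y + z + t)
        regroup = solve-∀

  raisedPyramid-sum-0 : ∀ N l g → Bounded.raisedPyramid-sum 0 N l g ≡ + 0
  raisedPyramid-sum-0 N l g = sumWords-vanishing (alphabet (suc (suc N))) l _ (λ w _ → Σ≤-vanishing N _ (λ i _ →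
    trans (cong (λ q → endsPath 0 w (suc i) * ι q * g (occEnd 0 w (suc i))) (∧-zeroʳ (isUᵏ 0 w)))
          (trans (cong (_* g (occEnd 0 w (suc i))) (ℤP.*-zeroʳ (endsPath 0 w (suc i)))) refl)))

  raisedPyramid-sum-suc : ∀ k'' N l g → k'' ≤ N → Bounded.raisedPyramid-sum (suc k'') N l g ≡ ι (l ≡ᵇ suc k'') * g 0
  raisedPyramid-sum-suc k'' N l g kle = trans (sumWords-cong a l (λ w _ → only-i≡k w)) sum-raisedTerm
    where
    open P.≡-Reasoning
    k' : ℕ
    k' = suc k''
    a : List Step
    a = alphabet (suc (suc N))
    raisedTerm : List Step → ℤ
    raisedTerm w = endsPath k' w k' * ι (isUᵏ k' w) * g (occEnd k' w k')
    only-i≡k : ∀ w → Σ≤ N (λ i → endsPath k' w (suc i) * ι (raisedIsPyramid k' w (suc i)) * g (occEnd k' w (suc i))) ≡ raisedTerm w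
    only-i≡k w = trans (Σ≤-single N k'' _ i≢k kle)
          (cong (λ q → endsPath k' w k' * ι q * g (occEnd k' w k')) (trans (cong (isUᵏ k' w ∧_) (≡ᵇ-refl k'')) (∧-identityʳ (isUᵏ k' w))))
      where
      i≢k : ∀ i → i ≢ k'' → endsPath k' w (suc i) * ι (raisedIsPyramid k' w (suc i)) * g (occEnd k' w (suc i)) ≡ + 0
      i≢k i ne = trans (cong (λ q → endsPath k' w (suc i) * ι q * g (occEnd k' w (suc i))) (trans (cong (isUᵏ k' w ∧_) (≢⇒≡ᵇ≡false (λ e → ne (sym e)))) (∧-zeroʳ _)))
                 (trans (cong (_* g (occEnd k' w (suc i))) (ℤP.*-zeroʳ (endsPath k' w (suc i)))) refl)
    Uᵏ-then-D : endsPath k' (replicate k' U) k' ≡ + 1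
    Uᵏ-then-D = cong ι (trans (go-Us 0 k' (D k' ∷ []))
           (trans (cong₂ (λ q r → q ∧ (r ≡ᵇ 0)) (≤⇒≤ᵇ≡true {k'} {k'} ℕP.≤-refl) (ℕP.n∸n≡0 k')) refl))
    Uᵏ-then-D-no-pyramid : occEnd k' (replicate k' U) k' ≡ 0
    Uᵏ-then-D-no-pyramid = trans (occ-snocD k' (replicate k' U) k')
          (cong₂ (λ q r → q ℕ.+ ιℕ (r ∧ (suc k' ≡ᵇ k'))) (occ-++-Us k' [] k') (endsWithUᵏ-short (suc k') (replicate k' U) (subst (_< suc k') (sym (LP.length-replicate k')) (ℕP.n<1+n k'))))
    sum-raisedTerm : sumWords a l raisedTerm ≡ ι (l ≡ᵇ suc k'') * g 0
    sum-raisedTerm with l ℕ.≟ k'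
    ... | yes refl = begin
      sumWords a k' raisedTerm ≡⟨ sumWords-cong a k' (λ w _ → rearrange (endsPath k' w k') (ι (isUᵏ k' w)) (g (occEnd k' w k'))) ⟩
      sumWords a k' (λ w → ι (isUᵏ k' w) * (endsPath k' w k' * g (occEnd k' w k'))) ≡⟨ sumWords-isUᵏ (suc N) k' (λ w → endsPath k' w k' * g (occEnd k' w k')) ⟩
      endsPath k' (replicate k' U) k' * g (occEnd k' (replicate k' U) k') ≡⟨ cong₂ (λ q r → q * g r) Uᵏ-then-D Uᵏ-then-D-no-pyramid ⟩
      + 1 * g 0 ≡⟨ cong (λ q → ι q * g 0) (sym (≡ᵇ-refl k')) ⟩
      ι (k' ≡ᵇ k') * g 0 ∎
      where
      rearrange : ∀ x y i≢k → x * y * i≢k ≡ y * (x * i≢k)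
      rearrange = solve-∀
    ... | no ne = trans (sumWords-vanishing a l raisedTerm (λ w e → trans (cong (λ q → endsPath k' w k' * ι q * g (occEnd k' w k')) (isUᵏ-wrongLength k' w (λ e2 → ne (trans (sym e) e2))))
                     (trans (cong (_* g (occEnd k' w k')) (ℤP.*-zeroʳ (endsPath k' w k'))) refl)))
                    (sym (cong (λ q → ι q * g 0) (≢⇒≡ᵇ≡false ne)))

  boundary-terms : ∀ k' N l m → k' ≤ N →
    UD₁-term k' l m + Bounded.raisedPyramid-sum k' N l (λ y → ι (suc y ≡ᵇ m)) + ι (l ≡ᵇ k') * ι (m ≡ᵇ 0)
    ≡ ι (l ≡ᵇ 0) * ι (m ≡ᵇ 0) + ι (l ≡ᵇ k') * ι (m ≡ᵇ 1) + Bounded.raisedPyramid-sum k' N l (λ y → ι (y ≡ᵇ m))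
  boundary-terms zero N l m kle = begin
    ι (l ≡ᵇ 0) * ι (1 ≡ᵇ m) + Bounded.raisedPyramid-sum 0 N l (λ y → ι (suc y ≡ᵇ m)) + ι (l ≡ᵇ 0) * ι (m ≡ᵇ 0)
      ≡⟨ cong₂ (λ q r → ι (l ≡ᵇ 0) * q + r + ι (l ≡ᵇ 0) * ι (m ≡ᵇ 0)) (cong ι (≡ᵇ-comm 1 m)) (raisedPyramid-sum-0 N l (λ y → ι (suc y ≡ᵇ m))) ⟩
    ι (l ≡ᵇ 0) * ι (m ≡ᵇ 1) + + 0 + ι (l ≡ᵇ 0) * ι (m ≡ᵇ 0) ≡⟨ rotate (ι (l ≡ᵇ 0) * ι (m ≡ᵇ 1)) (ι (l ≡ᵇ 0) * ι (m ≡ᵇ 0)) ⟩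
    ι (l ≡ᵇ 0) * ι (m ≡ᵇ 0) + ι (l ≡ᵇ 0) * ι (m ≡ᵇ 1) + + 0 ≡⟨ cong (λ q → ι (l ≡ᵇ 0) * ι (m ≡ᵇ 0) + ι (l ≡ᵇ 0) * ι (m ≡ᵇ 1) + q) (sym (raisedPyramid-sum-0 N l (λ y → ι (y ≡ᵇ m)))) ⟩
    ι (l ≡ᵇ 0) * ι (m ≡ᵇ 0) + ι (l ≡ᵇ 0) * ι (m ≡ᵇ 1) + Bounded.raisedPyramid-sum 0 N l (λ y → ι (y ≡ᵇ m)) ∎
    where
    open P.≡-Reasoning
    rotate : ∀ x y → x + + 0 + y ≡ y + x + + 0
    rotate = solve-∀
  boundary-terms (suc k'') N l m kle = begin
    ι (l ≡ᵇ 0) * ι (0 ≡ᵇ m) + Bounded.raisedPyramid-sum (suc k'') N l (λ y → ι (suc y ≡ᵇ m)) + ι (l ≡ᵇ suc k'') * ι (m ≡ᵇ 0)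
      ≡⟨ cong₂ (λ q r → ι (l ≡ᵇ 0) * q + r + ι (l ≡ᵇ suc k'') * ι (m ≡ᵇ 0)) (cong ι (≡ᵇ-comm 0 m)) (trans (raisedPyramid-sum-suc k'' N l (λ y → ι (suc y ≡ᵇ m)) (ℕP.<⇒≤ kle)) (cong (ι (l ≡ᵇ suc k'') *_) (cong ι (≡ᵇ-comm 1 m)))) ⟩
    ι (l ≡ᵇ 0) * ι (m ≡ᵇ 0) + ι (l ≡ᵇ suc k'') * ι (m ≡ᵇ 1) + ι (l ≡ᵇ suc k'') * ι (m ≡ᵇ 0)
      ≡⟨ cong (λ q → ι (l ≡ᵇ 0) * ι (m ≡ᵇ 0) + ι (l ≡ᵇ suc k'') * ι (m ≡ᵇ 1) + q)
           (sym (trans (raisedPyramid-sum-suc k'' N l (λ y → ι (y ≡ᵇ m)) (ℕP.<⇒≤ kle)) (cong (ι (l ≡ᵇ suc k'') *_) (cong ι (≡ᵇ-comm 0 m))))) ⟩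
    ι (l ≡ᵇ 0) * ι (m ≡ᵇ 0) + ι (l ≡ᵇ suc k'') * ι (m ≡ᵇ 1) + Bounded.raisedPyramid-sum (suc k'') N l (λ y → ι (y ≡ᵇ m)) ∎
    where open P.≡-Reasoning


module Shifts where

  open IntegerSums using (ι; Σ≤-single; Σ≤-0; Σ≤-cong; Σ≤-vanishing)
  open SeriesRing

  shiftX : ℕ → FPS → FPS
  shiftX zero F n m = F n m
  shiftX (suc j) F zero m = + 0
  shiftX (suc j) F (suc n) m = shiftX j F n m

  shiftY : FPS → FPS
  shiftY F n zero = + 0
  shiftY F n (suc m) = F n m

  X⊗≈shiftX : ∀ F → (X ⊗ F) ≈ shiftX 1 F
  X⊗≈shiftX F zero m = Σ≤-0 m
  X⊗≈shiftX F (suc n) m = trans (Σ≤-single (suc n) 1 _ i≢1-vanishes (s≤s z≤n))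
     (trans (Σ≤-single m 0 _ (λ { zero ne → ⊥-elim (ne refl) ; (suc j) _ → refl }) z≤n) (ℤP.*-identityˡ _))
    where
    open import Data.Empty using (⊥-elim)
    i≢1-vanishes : ∀ i → i ≢ 1 → Σ≤ m (λ j → X i j * F (suc n ∸ i) (m ∸ j)) ≡ + 0
    i≢1-vanishes zero _ = Σ≤-0 m
    i≢1-vanishes (suc zero) ne = ⊥-elim (ne refl)
    i≢1-vanishes (suc (suc i)) _ = Σ≤-0 m

  Y⊗≈shiftY : ∀ F → (Y ⊗ F) ≈ shiftY F
  Y⊗≈shiftY F n m = trans (Σ≤-single n 0 _ i≢0-vanishes z≤n) (y-column m)
    where
    open import Data.Empty using (⊥-elim)
    i≢0-vanishes : ∀ i → i ≢ 0 → Σ≤ m (λ j → Y i j * F (n ∸ i) (m ∸ j)) ≡ + 0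
    i≢0-vanishes zero ne = ⊥-elim (ne refl)
    i≢0-vanishes (suc i) _ = Σ≤-0 m
    y-column : ∀ m → Σ≤ m (λ j → Y 0 j * F n (m ∸ j)) ≡ shiftY F n m
    y-column zero = refl
    y-column (suc m) = trans (Σ≤-single (suc m) 1 _ (λ { zero _ → refl ; (suc zero) ne → ⊥-elim (ne refl) ; (suc (suc j)) _ → refl }) (s≤s z≤n))
                          (ℤP.*-identityˡ _)

  shiftX-cong : ∀ j {F G} → F ≈ G → shiftX j F ≈ shiftX j G
  shiftX-cong zero e n m = e n m
  shiftX-cong (suc j) e zero m = refl
  shiftX-cong (suc j) e (suc n) m = shiftX-cong j e n m

  shiftX-suc : ∀ j F → shiftX 1 (shiftX j F) ≈ shiftX (suc j) F
  shiftX-suc j F zero m = refl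
  shiftX-suc j F (suc n) m = refl

  X^^⊗≈shiftX : ∀ j F → (X ^^ j ⊗ F) ≈ shiftX j F
  X^^⊗≈shiftX zero F = FPS-ring.*-identityˡ F
  X^^⊗≈shiftX (suc j) F = FPS-ring.trans (FPS-ring.*-assoc X (X ^^ j) F) (FPS-ring.trans (FPS-ring.*-cong (FPS-ring.refl {X}) (X^^⊗≈shiftX j F)) (FPS-ring.trans (X⊗≈shiftX (shiftX j F)) (shiftX-suc j F)))

  X^^≈shiftX : ∀ j → X ^^ j ≈ shiftX j 𝟙
  X^^≈shiftX j = FPS-ring.trans (FPS-ring.sym (FPS-ring.*-identityʳ (X ^^ j))) (X^^⊗≈shiftX j 𝟙)

  Y≈shiftY : Y ≈ shiftY 𝟙
  Y≈shiftY zero zero = refl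
  Y≈shiftY zero (suc zero) = refl
  Y≈shiftY zero (suc (suc m)) = refl
  Y≈shiftY (suc n) zero = refl
  Y≈shiftY (suc n) (suc m) = refl

  shiftX-𝟙 : ∀ j n m → shiftX j 𝟙 n m ≡ ι (n ≡ᵇ j) * ι (m ≡ᵇ 0)
  shiftX-𝟙 zero zero zero = refl
  shiftX-𝟙 zero zero (suc m) = refl
  shiftX-𝟙 zero (suc n) m = refl
  shiftX-𝟙 (suc j) zero m = refl
  shiftX-𝟙 (suc j) (suc n) m = shiftX-𝟙 j n m

  shiftX-shiftY-𝟙 : ∀ j n m → shiftX j (shiftY 𝟙) n m ≡ ι (n ≡ᵇ j) * ι (m ≡ᵇ 1)
  shiftX-shiftY-𝟙 zero zero zero = refl
  shiftX-shiftY-𝟙 zero zero (suc zero) = refl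
  shiftX-shiftY-𝟙 zero zero (suc (suc m)) = refl
  shiftX-shiftY-𝟙 zero (suc n) zero = refl
  shiftX-shiftY-𝟙 zero (suc n) (suc m) = refl
  shiftX-shiftY-𝟙 (suc j) zero m = refl
  shiftX-shiftY-𝟙 (suc j) (suc n) m = shiftX-shiftY-𝟙 j n m

  shiftX-coeff : ∀ j F n m → shiftX j F n m ≡ ι (j ≤ᵇ n) * F (n ∸ j) m
  shiftX-coeff zero F n m = sym (ℤP.*-identityˡ _)
  shiftX-coeff (suc j) F zero m = refl
  shiftX-coeff (suc j) F (suc n) m = trans (shiftX-coeff j F n m) (cong (λ q → ι q * F (n ∸ j) m) (sym (suc≤ᵇsuc j n)))
    where
    suc≤ᵇsuc : ∀ j n → (suc j ≤ᵇ suc n) ≡ (j ≤ᵇ n)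
    suc≤ᵇsuc zero n = refl
    suc≤ᵇsuc (suc j) n = refl


module PyramidSeries (k' : ℕ) where

  open IntegerSums
  open WordSums
  open Pyramids
  open Factorisation hiding (K)
  open AlphabetIndependence
  open PrimePaths hiding (K)
  open SeriesRing
  open Shifts
  open ClosedForm using (primeForm; primeForm-unique)

  K : ℕ
  K = suc k'

  Paths : FPS
  Paths n m = pathCount k' (alphabet n) n m

  Primes : FPS
  Primes n m = primeCount k' (alphabet n) n m

  p≡pathCount : ∀ n m → + p K (suc n) m ≡ pathCount k' (alphabet (suc n)) (suc n) m
  p≡pathCount n m = trans (p≡sumWords K (suc n) m)
    (sumWords-cong (alphabet (suc n)) (suc n) {λ w → ι (isAirDyck w) * ι (occurrences (pyramid K) w ≡ᵇ m)}
      {λ w → ι (go 0 false w) * ι (occ K w ≡ᵇ m)} (λ { (s ∷ w) _ → refl }))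

  Paths≈𝟙⊕P : Paths ≈ (𝟙 ⊕ Pk K)
  Paths≈𝟙⊕P zero zero = refl
  Paths≈𝟙⊕P zero (suc m) = refl
  Paths≈𝟙⊕P (suc n) m = trans (sym (p≡pathCount n m)) (sym (ℤP.+-identityˡ _))

  P≈Primes⊗Paths : Pk K ≈ (Primes ⊗ Paths)
  P≈Primes⊗Paths zero m = sym (Σ≤-0 m)
  P≈Primes⊗Paths (suc n) m = begin
    + p K (suc n) m ≡⟨ p≡pathCount n m ⟩
    pathCount k' a (suc n) m ≡⟨ pathCount-firstReturn k' a n m ⟩
    Σ≤ (suc n) (λ i → Σ≤ m (λ j → primeCount k' a i j * pathCount k' a (suc n ∸ i) (m ∸ j)))
      ≡⟨ Σ≤-cong≤ (suc n) (λ i le → Σ≤-cong m (λ j → cong₂ _*_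
           (sumWords-canonical (suc n) i _ (primeIndicator-vanishes k' j) le)
           (sumWords-canonical (suc n) (suc n ∸ i) _ (pathIndicator-vanishes k' (m ∸ j)) (ℕP.m∸n≤m (suc n) i)))) ⟩
    (Primes ⊗ Paths) (suc n) m ∎
    where
    open P.≡-Reasoning
    a : List Step
    a = alphabet (suc n)

  primes-equation-lhs : FPS
  primes-equation-lhs n m = Primes n m + shiftX (suc (suc K)) (shiftY Paths) n m + shiftX (suc K) 𝟙 n m
  primes-equation-rhs : FPS
  primes-equation-rhs n m = shiftX 2 𝟙 n m + shiftX 1 (Pk K) n m + shiftX (suc K) (shiftY 𝟙) n m + shiftX (suc (suc K)) Paths n m

  shifted-pathCount : ∀ N l m → l ≤ N → sumWords (alphabet (suc (suc N))) (l ∸ K) (λ β → ι (go 0 false β) * ι (suc (occ K β) ≡ᵇ m)) ≡ shiftY Paths (l ∸ K) m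
  shifted-pathCount N l zero le = sumWords-vanishing (alphabet (suc (suc N))) (l ∸ K) _ (λ β _ → ℤP.*-zeroʳ (ι (go 0 false β)))
  shifted-pathCount N l (suc m) le = sumWords-canonical (suc (suc N)) (l ∸ K) _ (pathIndicator-vanishes k' m) (ℕP.≤-trans (ℕP.m∸n≤m l K) (ℕP.≤-trans le (ℕP.≤-trans (ℕP.n≤1+n N) (ℕP.n≤1+n _))))

  primes-equation-coefficients : ∀ n m → primes-equation-lhs n m ≡ primes-equation-rhs n m
  primes-equation-coefficients zero m = refl
  primes-equation-coefficients (suc zero) m = refl
  primes-equation-coefficients (suc (suc l)) m = begin
    Primes (suc (suc l)) m + shiftX K (shiftY Paths) l m + shiftX k' 𝟙 l m
      ≡⟨ cong₂ (λ q r → Primes (suc (suc l)) m + q + r) (shiftX-coeff K (shiftY Paths) l m) (shiftX-𝟙 k' l m) ⟩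
    Primes (suc (suc l)) m + ι (K ≤ᵇ l) * shiftY Paths (l ∸ K) m + w-coeff
      ≡⟨ cong₂ (λ q r → q + ι (K ≤ᵇ l) * r + w-coeff)
           (sym (sumWords-canonical (suc (suc N)) (suc (suc l)) _ (primeIndicator-vanishes k' m) (s≤s (s≤s l≤N))))
           (sym (shifted-pathCount N l m l≤N)) ⟩
    primeCount k' a (suc (suc l)) m + endingPyramids + w-coeff
      ≡⟨ add-and-subtract (primeCount k' a (suc (suc l)) m) endingPyramids w-coeff raisedPyramids ⟩
    (primeCount k' a (suc (suc l)) m + endingPyramids + raisedPyramids) + w-coeff - raisedPyramids
      ≡⟨ cong (λ q → q + w-coeff - raisedPyramids) (Bounded.primeCount-recurrence k' N l m l≤N k'≤N) ⟩
    (UD₁-term k' l m + pathCount k' a (suc l) m + shiftedPaths + raisedPyramids₊) + w-coeff - raisedPyramids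
      ≡⟨ regroup (UD₁-term k' l m) (pathCount k' a (suc l) m) shiftedPaths raisedPyramids₊ w-coeff raisedPyramids ⟩
    pathCount k' a (suc l) m + shiftedPaths + (UD₁-term k' l m + raisedPyramids₊ + w-coeff) - raisedPyramids
      ≡⟨ cong (λ q → pathCount k' a (suc l) m + shiftedPaths + q - raisedPyramids) (boundary-terms k' N l m k'≤N) ⟩
    pathCount k' a (suc l) m + shiftedPaths + (x²-coeff + wy-coeff + raisedPyramids) - raisedPyramids
      ≡⟨ cancel (pathCount k' a (suc l) m) shiftedPaths x²-coeff wy-coeff raisedPyramids ⟩
    x²-coeff + pathCount k' a (suc l) m + wy-coeff + shiftedPaths
      ≡⟨ cong₂ (λ q r → x²-coeff + q + wy-coeff + ι (K ≤ᵇ l) * r)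
           (trans (sumWords-canonical (suc (suc N)) (suc l) _ (pathIndicator-vanishes k' m) (s≤s (ℕP.m≤n⇒m≤1+n l≤N)))
                  (sym (p≡pathCount l m)))
           (sumWords-canonical (suc (suc N)) (l ∸ K) _ (pathIndicator-vanishes k' m)
             (ℕP.≤-trans (ℕP.m∸n≤m l K) (ℕP.≤-trans l≤N (ℕP.≤-trans (ℕP.n≤1+n N) (ℕP.n≤1+n _))))) ⟩
    x²-coeff + + p K (suc l) m + wy-coeff + ι (K ≤ᵇ l) * Paths (l ∸ K) m
      ≡⟨ cong₂ (λ q r → q + + p K (suc l) m + wy-coeff + r) (sym (shiftX-𝟙 0 l m)) (sym (shiftX-coeff K Paths l m)) ⟩
    𝟙 l m + + p K (suc l) m + wy-coeff + shiftX K Paths l m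
      ≡⟨ cong (λ q → 𝟙 l m + + p K (suc l) m + q + shiftX K Paths l m) (sym (shiftX-shiftY-𝟙 k' l m)) ⟩
    primes-equation-rhs (suc (suc l)) m ∎
    where
    open P.≡-Reasoning
    N : ℕ
    N = l ℕ.+ k'
    l≤N : l ≤ N
    l≤N = ℕP.m≤m+n l k'
    k'≤N : k' ≤ N
    k'≤N = ℕP.m≤n+m k' l
    a : List Step
    a = alphabet (suc (suc N))
    w-coeff : ℤ
    w-coeff = ι (l ≡ᵇ k') * ι (m ≡ᵇ 0)
    wy-coeff : ℤ
    wy-coeff = ι (l ≡ᵇ k') * ι (m ≡ᵇ 1)
    x²-coeff : ℤ
    x²-coeff = ι (l ≡ᵇ 0) * ι (m ≡ᵇ 0)
    endingPyramids : ℤ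
    endingPyramids = ι (K ≤ᵇ l) * sumWords a (l ∸ K) (λ β → ι (go 0 false β) * ι (suc (occ K β) ≡ᵇ m))
    shiftedPaths : ℤ
    shiftedPaths = ι (K ≤ᵇ l) * pathCount k' a (l ∸ K) m
    raisedPyramids : ℤ
    raisedPyramids = Bounded.raisedPyramid-sum k' N l (λ y → ι (y ≡ᵇ m))
    raisedPyramids₊ : ℤ
    raisedPyramids₊ = Bounded.raisedPyramid-sum k' N l (λ y → ι (suc y ≡ᵇ m))
    add-and-subtract : ∀ x y z t → x + y + z ≡ x + y + t + z - t
    add-and-subtract = solve-∀
    regroup : ∀ x y z t u v → x + y + z + t + u - v ≡ y + z + (x + t + u) - v
    regroup = solve-∀
    cancel : ∀ y z x t u → y + z + (x + t + u) - u ≡ x + y + t + z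
    cancel = solve-∀

  primes-equation :
    Primes ⊕ X ⊗ X ^^ suc K ⊗ (Y ⊗ Paths) ⊕ X ^^ suc K ≈ X ^^ 2 ⊕ X ⊗ Pk K ⊕ X ^^ suc K ⊗ Y ⊕ X ⊗ X ^^ suc K ⊗ Paths
  primes-equation n m = begin
    Primes n m + ((X ⊗ X ^^ suc K) ⊗ (Y ⊗ Paths)) n m + (X ^^ suc K) n m
      ≡⟨ cong₂ (λ q r → Primes n m + q + r) (FPS-ring.trans (X^^⊗≈shiftX (suc (suc K)) (Y ⊗ Paths)) (shiftX-cong (suc (suc K)) (Y⊗≈shiftY Paths)) n m) (X^^≈shiftX (suc K) n m) ⟩
    primes-equation-lhs n m ≡⟨ primes-equation-coefficients n m ⟩
    primes-equation-rhs n m ≡⟨ sym (cong₂ (λ q r → q + r + shiftX (suc K) (shiftY 𝟙) n m + shiftX (suc (suc K)) Paths n m) (X^^≈shiftX 2 n m) (X⊗≈shiftX (Pk K) n m)) ⟩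
    (X ^^ 2) n m + (X ⊗ Pk K) n m + shiftX (suc K) (shiftY 𝟙) n m + shiftX (suc (suc K)) Paths n m
      ≡⟨ sym (cong₂ (λ q r → (X ^^ 2) n m + (X ⊗ Pk K) n m + q + r) (FPS-ring.trans (X^^⊗≈shiftX (suc K) Y) (shiftX-cong (suc K) Y≈shiftY) n m) (X^^⊗≈shiftX (suc (suc K)) Paths n m)) ⟩
    (X ^^ 2) n m + (X ⊗ Pk K) n m + (X ^^ suc K ⊗ Y) n m + ((X ⊗ X ^^ suc K) ⊗ Paths) n m ∎
    where open P.≡-Reasoning

  functional-equation : Pk K ≈ primeForm (X ^^ suc K) (Pk K) ⊗ (𝟙 ⊕ Pk K)
  functional-equation = FPS-ring.trans P≈Primes⊗Paths
    (FPS-ring.*-cong (primeForm-unique {Primes} {Pk K} {Paths} {X ^^ suc K} Paths≈𝟙⊕P primes-equation) Paths≈𝟙⊕P)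


open ClosedForm using (primeForm; square-root-identity; a≈b⊕[a⊖b])

theorem6 : (k : ℕ) → k ≥ 1 →
    ∃ λ S → IsSqrt S (Qk k) × (Den k ⊗ Pk k ≈ Num k ⊕ S)
theorem6 k@(suc k') _ = S , (S⊗S≈Qk , refl) , a≈b⊕[a⊖b] (Den k ⊗ Pk k) (Num k)
  where
  S : FPS
  S = Den k ⊗ Pk k ⊖ Num k
  functional-equation : Pk k ≈ primeForm (X ^^ (k ℕ.+ 1)) (Pk k) ⊗ (𝟙 ⊕ Pk k)
  functional-equation = subst (λ w → Pk k ≈ primeForm w (Pk k) ⊗ (𝟙 ⊕ Pk k))
    (cong (X ^^_) (ℕP.+-comm 1 k)) (PyramidSeries.functional-equation k')
  S⊗S≈Qk : S ⊗ S ≈ Qk k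
  S⊗S≈Qk = square-root-identity (X ^^ (k ℕ.+ 1)) (X ^^ (k ℕ.+ 2)) (Pk k)
    (cong (X ^^_) (ℕP.+-suc k 1)) functional-equation
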